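{- Let $q$ be an odd prime power, and let $m,t$ be integers with $t\ge1$ and $2t\le m$. If $c=(-\operatorname{tr}(FA))_{A\in\mathbb{A}(2t,m)}\in\widehat{C}_{\mathbf{A}}(2t,m)$ for a skew-symmetric matrix $F\in\mathbb{A}_m$, then the Hamming weight of $c$ depends only on the rank of $F$. Moreover, there are at most $\lfloor m/2\rfloor$ distinct values for the Hamming weight of a nonzero codeword of $C_{\mathbf{A}}(2t,m)$.
   Context: A skew-symmetric $m\times m$ matrix over $\mathbb{F}_q$ is a matrix $A=(a_{ij})$ with $A^T=-A$ and all diagonal entries zero; $\mathbb{A}_m$ denotes the space of these. For an integer $s$, $\mathbb{A}(s,m)=\{A\in\mathbb{A}_m:\operatorname{rank}(A)\le s\}$ and $N_a(s,m)=|\mathbb{A}(s,m)|$. For a linear form $f=\sum_{1\le i<j\le m}f_{ij}X_{ij}$ over $\mathbb{F}_q$ and $A=(a_{ij})\in\mathbb{A}_m$, set $f(A)=\sum_{i<j}f_{ij}a_{ij}$. The code $\widehat{C}_{\mathbf{A}}(2t,m)$ consists of all words $(f(A))_{A\in\mathbb{A}(2t,m)}$ (coordinates indexed by $\mathbb{A}(2t,m)$). Let $B_1,\dots,B_N$ be a choice of one representative for each point of the projective space $\mathbb{P}(\mathbb{A}_m)$ coming from a nonzero matrix of rank $\le 2t$; the skew determinantal code $C_{\mathbf{A}}(2t,m)\subseteq\mathbb{F}_q^N$ consists of all words $(f(B_1),\dots,f(B_N))$ (its weights do not depend on the choice of representatives or ordering). The Hamming weight of a word is its number of nonzero coordinates.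 -}

module Defs where

open import Level using (Level; _⊔_) renaming (suc to lsuc)
open import Algebra.Bundles using (CommutativeRing)
open import Data.Nat using (ℕ; zero; suc)
import Data.Nat
open import Data.Fin using (Fin; _<?_)
import Data.Fin as Fin
open import Data.Bool using (if_then_else_)
open import Data.List using (List; length)
open import Data.List.Relation.Unary.All using (All)
open import Data.List.Relation.Unary.Any using (Any)
open import Data.List.Relation.Unary.AllPairs using (AllPairs)
open import Data.Product using (Σ; ∃; _×_)
open import Relation.Nullary using (¬_; does)
open import Relation.Binary.PropositionalEquality using (_≡_)
open import Relation.Binary.Definitions using (Decidable)

-- A finite field: a commutative ring (with setoid equality) that is a field
-- (0 ≠ 1, nonzero elements invertible), has decidable equality, and whose
-- carrier is finite (enumerated by a complete list).  Every such field is
-- F_q for a prime power q.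
record FiniteField (c ℓ : Level) : Set (lsuc (c ⊔ ℓ)) where
  field
    commRing : CommutativeRing c ℓ
  open CommutativeRing commRing public
  field
    _≟_      : Decidable _≈_
    0≉1      : ¬ (0# ≈ 1#)
    inverse  : ∀ x → ¬ (x ≈ 0#) → ∃ λ y → x * y ≈ 1#
    elements : List Carrier
    complete : ∀ x → Any (x ≈_) elements

-- q odd  ⇔  characteristic ≠ 2  ⇔  1 + 1 ≠ 0.
OddOrder : ∀ {c ℓ} → FiniteField c ℓ → Set ℓ
OddOrder 𝔽 = ¬ ((1# + 1#) ≈ 0#) where open FiniteField 𝔽

module FF {c ℓ} (𝔽 : FiniteField c ℓ) where
  open FiniteField 𝔽

  sumF : (n : ℕ) → (Fin n → Carrier) → Carrier
  sumF zero    g = 0#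
  sumF (suc n) g = g Fin.zero + sumF n (λ i → g (Fin.suc i))

  Mat : ℕ → Set c
  Mat m = Fin m → Fin m → Carrier

  _≋_ : ∀ {m} → Mat m → Mat m → Set ℓ
  A ≋ B = ∀ i j → A i j ≈ B i j

  zeroMat : ∀ {m} → Mat m
  zeroMat i j = 0#

  Skew : ∀ {m} → Mat m → Set ℓ
  Skew {m} A = (∀ i j → A j i ≈ - (A i j)) × (∀ i → A i i ≈ 0#)

  LinIndep : ∀ {k m} → (Fin k → Fin m → Carrier) → Set (c ⊔ ℓ)
  LinIndep {k} {m} v =
    ∀ (a : Fin k → Carrier) →
      (∀ j → sumF k (λ i → a i * v i j) ≈ 0#) → ∀ i → a i ≈ 0#

  RankLe : ∀ {m} → Mat m → ℕ → Set (c ⊔ ℓ)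
  RankLe {m} A s = ∀ (σ : Fin (suc s) → Fin m) → ¬ LinIndep (λ i → A (σ i))

  HasRank : ∀ {m} → Mat m → ℕ → Set (c ⊔ ℓ)
  HasRank {m} A r =
    (∃ λ (ρ : Fin r → Fin m) → LinIndep (λ i → A (ρ i))) × RankLe A r

  tr : ∀ {m} → Mat m → Mat m → Carrier
  tr {m} F A = sumF m (λ i → sumF m (λ j → F i j * A j i))

  -- evaluation of the linear form f = Σ_{i<j} f_ij X_ij at A
  evalForm : ∀ {m} → Mat m → Mat m → Carrier
  evalForm {m} f A =
    sumF m (λ i → sumF m (λ j → if does (i <? j) then f i j * A i j else 0#))

  Card : ∀ {m} → (Mat m → Set (c ⊔ ℓ)) → ℕ → Set (c ⊔ ℓ)
  Card {m} P n = Σ (List (Mat m)) λ xs →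
    length xs ≡ n × All P xs × AllPairs (λ A B → ¬ (A ≋ B)) xs
    × (∀ A → P A → Any (A ≋_) xs)

  -- A and B represent the same projective point
  Proportional : ∀ {m} → Mat m → Mat m → Set (c ⊔ ℓ)
  Proportional A B = ∃ λ λ′ → ¬ (λ′ ≈ 0#) × (∀ i j → A i j ≈ λ′ * B i j)

  -- the set of projective points [A] with P A has exactly n elements
  ProjCard : ∀ {m} → (Mat m → Set (c ⊔ ℓ)) → ℕ → Set (c ⊔ ℓ)
  ProjCard {m} P n = Σ (List (Mat m)) λ xs →
    length xs ≡ n × All P xs × AllPairs (λ A B → ¬ Proportional A B) xs
    × (∀ A → P A → Any (Proportional A) xs)

  -- Hamming weight of c = (-tr(FA))_{A ∈ 𝔸(2t,m)} in Ĉ_A(2t,m) is w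
  HatWeight : (m t : ℕ) → Mat m → ℕ → Set (c ⊔ ℓ)
  HatWeight m t F w =
    Card (λ A → Skew A × RankLe A (2 Data.Nat.* t) × ¬ ((- tr F A) ≈ 0#)) w

  -- Hamming weight of the codeword of C_A(2t,m) given by the form f is w
  ProjWeight : (m t : ℕ) → Mat m → ℕ → Set (c ⊔ ℓ)
  ProjWeight m t f w =
    ProjCard (λ B → Skew B × ¬ (B ≋ zeroMat) × RankLe B (2 Data.Nat.* t)
                    × ¬ (evalForm f B ≈ 0#)) w

module Submission where

-- The codeword c_G = (-tr(G A))_{A ∈ 𝔸(2t,m)} is transported to c_H
-- by the bijection A ↦ Qᵀ A Q of 𝔸(2t,m) whenever H = P G Pᵀ with P Q = I,
-- because tr(G A) = tr(H (Qᵀ A Q)).  Every skew matrix is congruent to a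
-- normal form Nf k m = J ⊕ ⋯ ⊕ J ⊕ 0 (k blocks J = [[0,1],[-1,0]]), whose
-- rank is 2k; hence the weight of c_G depends only on rank G.  A linear form
-- f corresponds to the skew matrix F_f (entries of f below the diagonal,
-- antisymmetrised) with tr(F_f B) = 2 f(B), so in odd characteristic the
-- projective codeword of f has the weight attached to the normal form of
-- F_f; only the ⌊m/2⌋ normal forms with k ≥ 1 give nonzero words.

open import Level using (_⊔_)
open import Data.Nat as ℕ using (ℕ; zero; suc; z≤n; s≤s)
import Data.Nat.Properties as ℕₚ
open import Data.Nat.DivMod using (m*n/n≡m; /-monoˡ-≤)
open import Data.Fin using (Fin; zero; suc; punchIn; toℕ; fromℕ<; _<?_)
import Data.Fin.Properties as Finₚ
open import Data.Fin.Permutation.Components using (transpose; transpose-inverse)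
open import Data.Bool using (true; false; if_then_else_)
open import Data.List using (List; []; _∷_; map; length; allFin; applyUpTo; cartesianProductWith)
open import Data.List.Properties using (length-map; length-applyUpTo)
open import Data.List.Relation.Unary.Any using (Any; here; there)
import Data.List.Relation.Unary.Any as Any
import Data.List.Relation.Unary.Any.Properties as Anyₚ
open import Data.List.Relation.Unary.All using (All; []; _∷_; lookupAny; tabulate)
import Data.List.Relation.Unary.All as All
import Data.List.Relation.Unary.All.Properties as Allₚ
open import Data.List.Relation.Unary.AllPairs using (AllPairs; []; _∷_)
import Data.List.Relation.Unary.AllPairs as AllPairs
import Data.List.Relation.Unary.AllPairs.Properties as AllPairsₚ
open import Data.List.Membership.Propositional using (_∈_)
open import Data.List.Membership.Propositional.Properties using (∈-allFin; ∈-applyUpTo⁺)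
open import Data.Product using (Σ; ∃; _×_; _,_; proj₁; proj₂)
open import Data.Empty using (⊥-elim)
import Data.Vec.Functional as Vector
open import Data.Vec.Functional.Properties using (insertAt-lookup; insertAt-punchIn)
open import Function using (_∘_)
open import Relation.Nullary using (¬_; Dec; yes; no; does)
open import Relation.Nullary.Decidable using (_→-dec_; _×-dec_; ¬?; dec-true; dec-false)
open import Relation.Binary.PropositionalEquality as ≡ using (_≡_; _≢_)
open import Defs

-- Exhaustive search over functions Fin n → X, for X covered (up to a
-- relation _∼_) by a finite list.  It makes every pointwise-decidable
-- property of such functions (linear independence, rank bounds) decidable.
module Enumeration {a r} {X : Set a} (_∼_ : X → X → Set r)
                   (xs : List X) (cover : ∀ x → Any (x ∼_) xs) where

  _≅_ : ∀ {n} → (Fin n → X) → (Fin n → X) → Set r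
  f ≅ g = ∀ i → f i ∼ g i

  functions : (n : ℕ) → List (Fin n → X)
  functions zero    = (λ ()) ∷ []
  functions (suc n) = cartesianProductWith Vector._∷_ xs (functions n)

  functions-cover : ∀ n (f : Fin n → X) → Any (f ≅_) (functions n)
  functions-cover zero    f = here (λ ())
  functions-cover (suc n) f =
    Anyₚ.cartesianProductWith⁺ Vector._∷_ (λ f₀∼x f₊≅g → λ { zero → f₀∼x ; (suc i) → f₊≅g i })
      (cover (f zero)) (functions-cover n (λ i → f (suc i)))

  module _ {n p} (P : (Fin n → X) → Set p) (P? : ∀ f → Dec (P f)) where

    all? : (∀ {f g} → f ≅ g → P g → P f) → Dec (∀ f → P f)
    all? resp with All.all? P? (functions n)
    ... | yes all = yes λ f → let (Pg , f≅g) = lookupAny all (functions-cover n f) in resp f≅g Pg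
    ... | no ¬all = no λ ∀P → ¬all (tabulate (λ {g} _ → ∀P g))

    any? : (∀ {f g} → f ≅ g → P f → P g) → Dec (∃ P)
    any? resp with Any.any? P? (functions n)
    ... | yes some = yes (Any.satisfied some)
    ... | no ¬some = no λ (f , Pf) → ¬some (Any.map (λ f≅g → resp f≅g Pf) (functions-cover n f))

-- From a list covering a decidable predicate P, extract a list of pairwise
-- inequivalent elements satisfying P which still covers P up to _~_.  This
-- is how the cardinalities in the theorem are shown to exist.
module Representatives {a p r} {X : Set a} (P : X → Set p) (P? : ∀ x → Dec (P x))
    (_~_ : X → X → Set r) (_~?_ : ∀ x y → Dec (x ~ y))
    (~-trans : ∀ {x y z} → x ~ y → y ~ z → x ~ z)
    (P-resp : ∀ {x y} → x ~ y → P x → P y) where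

  record Selection (xs : List X) : Set (a ⊔ p ⊔ r) where
    field
      reps     : List X
      all-P    : All P reps
      distinct : AllPairs (λ u v → ¬ (u ~ v)) reps
      covers   : ∀ x → P x → Any (x ~_) xs → Any (x ~_) reps

  select : ∀ xs → Selection xs
  select [] = record { reps = [] ; all-P = [] ; distinct = [] ; covers = λ _ _ () }
  select (x ∷ xs) with select xs | P? x
  ... | R | no ¬Px = record
    { reps = reps ; all-P = all-P ; distinct = distinct
    ; covers = λ { y Py (here y~x) → ⊥-elim (¬Px (P-resp y~x Py)) ; y Py (there q) → covers y Py q } }
    where open Selection R
  ... | R | yes Px with Any.any? (x ~?_) (Selection.reps R)
  ...   | yes x~rep = record
    { reps = reps ; all-P = all-P ; distinct = distinct
    ; covers = λ { y Py (here y~x) → Any.map (~-trans y~x) x~rep ; y Py (there q) → covers y Py q } }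
    where open Selection R
  ...   | no ¬x~rep = record
    { reps     = x ∷ reps
    ; all-P    = Px ∷ all-P
    ; distinct = Allₚ.¬Any⇒All¬ reps ¬x~rep ∷ distinct
    ; covers   = λ { y Py (here y~x) → here y~x ; y Py (there q) → there (covers y Py q) } }
    where open Selection R

module Sums {c ℓ} (𝔽 : FiniteField c ℓ) where
  open FiniteField 𝔽 hiding (zero)
  open FF 𝔽
  open import Relation.Binary.Reasoning.Setoid setoid
  open import Algebra.Properties.Ring ring using (-‿distribˡ-*; -0#≈0#; -‿+-comm)
  open import Algebra.Solver.Ring.NaturalCoefficients.Default commutativeSemiring
    using (solve; _:+_; _:=_)

  sum-cong : ∀ n {g h : Fin n → Carrier} → (∀ i → g i ≈ h i) → sumF n g ≈ sumF n h
  sum-cong zero    g≈h = refl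
  sum-cong (suc n) g≈h = +-cong (g≈h zero) (sum-cong n (λ i → g≈h (suc i)))

  sum-zero : ∀ n {g : Fin n → Carrier} → (∀ i → g i ≈ 0#) → sumF n g ≈ 0#
  sum-zero zero    g≈0 = refl
  sum-zero (suc n) g≈0 = trans (+-cong (g≈0 zero) (sum-zero n (λ i → g≈0 (suc i)))) (+-identityʳ 0#)

  sum-+ : ∀ n (g h : Fin n → Carrier) → sumF n (λ i → g i + h i) ≈ sumF n g + sumF n h
  sum-+ zero    g h = sym (+-identityʳ 0#)
  sum-+ (suc n) g h = begin
    (g zero + h zero) + sumF n (λ i → g (suc i) + h (suc i))
      ≈⟨ +-congˡ (sum-+ n _ _) ⟩
    (g zero + h zero) + (sumF n (λ i → g (suc i)) + sumF n (λ i → h (suc i)))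
      ≈⟨ solve 4 (λ a b c d → ((a :+ b) :+ (c :+ d)) := ((a :+ c) :+ (b :+ d))) refl _ _ _ _ ⟩
    (g zero + sumF n (λ i → g (suc i))) + (h zero + sumF n (λ i → h (suc i))) ∎

  sum-*ˡ : ∀ n x (g : Fin n → Carrier) → sumF n (λ i → x * g i) ≈ x * sumF n g
  sum-*ˡ zero    x g = sym (zeroʳ x)
  sum-*ˡ (suc n) x g = trans (+-congˡ (sum-*ˡ n x _)) (sym (distribˡ x _ _))

  sum-*ʳ : ∀ n x (g : Fin n → Carrier) → sumF n (λ i → g i * x) ≈ sumF n g * x
  sum-*ʳ n x g = trans (sum-cong n (λ i → *-comm _ _)) (trans (sum-*ˡ n x g) (*-comm _ _))

  sum-neg : ∀ n (g : Fin n → Carrier) → sumF n (λ i → - g i) ≈ - sumF n g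
  sum-neg zero    g = sym -0#≈0#
  sum-neg (suc n) g = trans (+-congˡ (sum-neg n _)) (-‿+-comm _ _)

  sum-swap : ∀ n k (g : Fin n → Fin k → Carrier) →
    sumF n (λ i → sumF k (g i)) ≈ sumF k (λ j → sumF n (λ i → g i j))
  sum-swap zero    k g = sym (sum-zero k (λ j → refl))
  sum-swap (suc n) k g = begin
    sumF k (g zero) + sumF n (λ i → sumF k (g (suc i)))
      ≈⟨ +-congˡ (sum-swap n k (λ i → g (suc i))) ⟩
    sumF k (g zero) + sumF k (λ j → sumF n (λ i → g (suc i) j))
      ≈⟨ sym (sum-+ k _ _) ⟩
    sumF k (λ j → g zero j + sumF n (λ i → g (suc i) j)) ∎

  -- A double sum of an alternating array (g j i = - g i j, g i i = 0)
  -- vanishes in every characteristic; this gives xᵀ F x = 0 for skew F.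
  sum-alternating : ∀ n (g : Fin n → Fin n → Carrier) →
    (∀ i j → g j i ≈ - g i j) → (∀ i → g i i ≈ 0#) → sumF n (λ i → sumF n (g i)) ≈ 0#
  sum-alternating zero    g anti diag = refl
  sum-alternating (suc n) g anti diag = begin
    (g zero zero + row) + sumF n (λ i → g (suc i) zero + sumF n (λ j → g (suc i) (suc j)))
      ≈⟨ +-cong (+-congʳ (diag zero)) (sum-+ n _ _) ⟩
    (0# + row) + (sumF n (λ i → g (suc i) zero) + sumF n (λ i → sumF n (λ j → g (suc i) (suc j))))
      ≈⟨ +-cong (+-identityˡ row) (+-cong column inner) ⟩
    row + (- row + 0#)
      ≈⟨ trans (+-congˡ (+-identityʳ _)) (-‿inverseʳ row) ⟩
    0# ∎
    where
      row = sumF n (λ j → g zero (suc j))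
      column : sumF n (λ i → g (suc i) zero) ≈ - row
      column = trans (sum-cong n (λ i → anti zero (suc i))) (sum-neg n _)
      inner : sumF n (λ i → sumF n (λ j → g (suc i) (suc j))) ≈ 0#
      inner = sum-alternating n (λ i j → g (suc i) (suc j))
                (λ i j → anti (suc i) (suc j)) (λ i → diag (suc i))

  sum-punchIn : ∀ n (p : Fin (suc n)) (g : Fin (suc n) → Carrier) →
    sumF (suc n) g ≈ g p + sumF n (λ i → g (punchIn p i))
  sum-punchIn n       zero    g = refl
  sum-punchIn (suc n) (suc p) g = begin
    g zero + sumF (suc n) (λ i → g (suc i))
      ≈⟨ +-congˡ (sum-punchIn n p (λ i → g (suc i))) ⟩
    g zero + (g (suc p) + sumF n (λ i → g (suc (punchIn p i))))
      ≈⟨ solve 3 (λ a b c → (a :+ (b :+ c)) := (b :+ (a :+ c))) refl _ _ _ ⟩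
    g (suc p) + (g zero + sumF n (λ i → g (suc (punchIn p i)))) ∎

  δ : ∀ {n} → Fin n → Fin n → Carrier
  δ i j = if does (i Finₚ.≟ j) then 1# else 0#

  δ-same : ∀ {n} (i : Fin n) → δ i i ≈ 1#
  δ-same i with i Finₚ.≟ i
  ... | yes _  = refl
  ... | no i≢i = ⊥-elim (i≢i ≡.refl)

  δ-diff : ∀ {n} {i j : Fin n} → i ≢ j → δ i j ≈ 0#
  δ-diff {i = i} {j} i≢j with i Finₚ.≟ j
  ... | yes i≡j = ⊥-elim (i≢j i≡j)
  ... | no _    = refl

  δ-sym : ∀ {n} (i j : Fin n) → δ i j ≈ δ j i
  δ-sym i j with i Finₚ.≟ j | j Finₚ.≟ i
  ... | yes _   | yes _   = refl
  ... | no _    | no _    = refl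
  ... | yes i≡j | no j≢i  = ⊥-elim (j≢i (≡.sym i≡j))
  ... | no i≢j  | yes j≡i = ⊥-elim (i≢j (≡.sym j≡i))

  sum-δˡ : ∀ n (i : Fin n) (g : Fin n → Carrier) → sumF n (λ j → δ i j * g j) ≈ g i
  sum-δˡ (suc n) zero g = begin
    1# * g zero + sumF n (λ j → 0# * g (suc j))
      ≈⟨ +-cong (*-identityˡ _) (sum-zero n (λ j → zeroˡ _)) ⟩
    g zero + 0#  ≈⟨ +-identityʳ _ ⟩
    g zero ∎
  sum-δˡ (suc n) (suc i) g = begin
    0# * g zero + sumF n (λ j → δ i j * g (suc j))
      ≈⟨ +-cong (zeroˡ _) (sum-δˡ n i (λ j → g (suc j))) ⟩
    0# + g (suc i)  ≈⟨ +-identityˡ _ ⟩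
    g (suc i) ∎

  sum-δʳ : ∀ n (i : Fin n) (g : Fin n → Carrier) → sumF n (λ j → g j * δ i j) ≈ g i
  sum-δʳ n i g = trans (sum-cong n (λ j → *-comm _ _)) (sum-δˡ n i g)

  sum-δ-δ : ∀ n (i j : Fin n) (g : Fin n → Carrier) →
    sumF n (λ l → (δ i l + - δ j l) * g l) ≈ g i + - g j
  sum-δ-δ n i j g =
    trans (sum-cong n (λ l → trans (distribʳ _ _ _) (+-congˡ (sym (-‿distribˡ-* _ _)))))
      (trans (sum-+ n _ _) (+-cong (sum-δˡ n i g) (trans (sum-neg n _) (-‿cong (sum-δˡ n j g)))))

module Matrices {c ℓ} (𝔽 : FiniteField c ℓ) where
  open FiniteField 𝔽 hiding (zero)
  open FF 𝔽
  open Sums 𝔽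
  open import Relation.Binary.Reasoning.Setoid setoid
  open import Algebra.Properties.Ring ring using (-‿distribˡ-*; -‿distribʳ-*)
  open import Algebra.Solver.Ring.NaturalCoefficients.Default commutativeSemiring
    using (solve; _:*_; _:=_)

  module _ {m : ℕ} where
    ≋-refl : {A : Mat m} → A ≋ A
    ≋-refl i j = refl

    ≋-sym : {A B : Mat m} → A ≋ B → B ≋ A
    ≋-sym A≋B i j = sym (A≋B i j)

    ≋-trans : {A B C : Mat m} → A ≋ B → B ≋ C → A ≋ C
    ≋-trans A≋B B≋C i j = trans (A≋B i j) (B≋C i j)

    infixl 25 _·_
    _·_ : Mat m → Mat m → Mat m
    (P · Q) a b = sumF m (λ u → P a u * Q u b)

    I : Mat m
    I = δ

    infix 30 _ᵀ
    _ᵀ : Mat m → Mat m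
    (P ᵀ) a b = P b a

    β : Mat m → (Fin m → Carrier) → (Fin m → Carrier) → Carrier
    β F x y = sumF m (λ u → sumF m (λ v → (x u * F u v) * y v))

    conj : Mat m → Mat m → Mat m
    conj P F a b = β F (P a) (P b)

    ·-cong : ∀ {P P′ Q Q′ : Mat m} → P ≋ P′ → Q ≋ Q′ → P · Q ≋ P′ · Q′
    ·-cong P≋ Q≋ a b = sum-cong m (λ u → *-cong (P≋ a u) (Q≋ u b))

    β-cong : ∀ {F F′ : Mat m} {x x′ y y′} → F ≋ F′ →
      (∀ i → x i ≈ x′ i) → (∀ i → y i ≈ y′ i) → β F x y ≈ β F′ x′ y′
    β-cong F≋ x≈ y≈ = sum-cong m (λ u → sum-cong m (λ v → *-cong (*-cong (x≈ u) (F≋ u v)) (y≈ v)))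

    conj-cong : ∀ {P P′ F F′ : Mat m} → P ≋ P′ → F ≋ F′ → conj P F ≋ conj P′ F′
    conj-cong P≋ F≋ a b = β-cong F≋ (P≋ a) (P≋ b)

    ·-assoc : ∀ (A B C : Mat m) → (A · B) · C ≋ A · (B · C)
    ·-assoc A B C a b = begin
      sumF m (λ v → sumF m (λ u → A a u * B u v) * C v b)
        ≈⟨ sum-cong m (λ v → sym (sum-*ʳ m _ _)) ⟩
      sumF m (λ v → sumF m (λ u → (A a u * B u v) * C v b))
        ≈⟨ sum-swap m m _ ⟩
      sumF m (λ u → sumF m (λ v → (A a u * B u v) * C v b))
        ≈⟨ sum-cong m (λ u → trans (sum-cong m (λ v → *-assoc _ _ _)) (sum-*ˡ m _ _)) ⟩
      sumF m (λ u → A a u * sumF m (λ v → B u v * C v b)) ∎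

    ·-identityˡ : ∀ (A : Mat m) → I · A ≋ A
    ·-identityˡ A a b = sum-δˡ m a _

    ·-ᵀ : ∀ (P Q : Mat m) → Q ᵀ · P ᵀ ≋ (P · Q) ᵀ
    ·-ᵀ P Q a b = sum-cong m (λ u → *-comm _ _)

    β-δ-δ : ∀ (F : Mat m) u v → β F (δ u) (δ v) ≈ F u v
    β-δ-δ F u v = trans (sum-cong m (λ w → sum-δʳ m v _)) (sum-δˡ m u _)

    conj-I : ∀ (F : Mat m) → conj I F ≋ F
    conj-I = β-δ-δ

    β-linearˡ : ∀ (F : Mat m) (g : Fin m → Carrier) (X : Mat m) y →
      β F (λ t → sumF m (λ u → g u * X u t)) y ≈ sumF m (λ u → g u * β F (X u) y)
    β-linearˡ F g X y = begin
      sumF m (λ t → sumF m (λ v → (sumF m (λ u → g u * X u t) * F t v) * y v))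
        ≈⟨ sum-cong m (λ t → sum-cong m (λ v →
             trans (*-congʳ (sym (sum-*ʳ m _ _))) (sym (sum-*ʳ m _ _)))) ⟩
      sumF m (λ t → sumF m (λ v → sumF m (λ u → ((g u * X u t) * F t v) * y v)))
        ≈⟨ trans (sum-cong m (λ t → sum-swap m m _)) (sum-swap m m _) ⟩
      sumF m (λ u → sumF m (λ t → sumF m (λ v → ((g u * X u t) * F t v) * y v)))
        ≈⟨ sum-cong m (λ u → sum-cong m (λ t → sum-cong m (λ v →
             solve 4 (λ a b c d → (((a :* b) :* c) :* d) := (a :* ((b :* c) :* d))) refl _ _ _ _))) ⟩
      sumF m (λ u → sumF m (λ t → sumF m (λ v → g u * ((X u t * F t v) * y v))))
        ≈⟨ sum-cong m (λ u → trans (sum-cong m (λ t → sum-*ˡ m _ _)) (sum-*ˡ m _ _)) ⟩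
      sumF m (λ u → g u * β F (X u) y) ∎

    β-linearʳ : ∀ (F : Mat m) x (g : Fin m → Carrier) (X : Mat m) →
      β F x (λ t → sumF m (λ u → g u * X u t)) ≈ sumF m (λ u → g u * β F x (X u))
    β-linearʳ F x g X = begin
      sumF m (λ t → sumF m (λ v → (x t * F t v) * sumF m (λ u → g u * X u v)))
        ≈⟨ sum-cong m (λ t → sum-cong m (λ v → sym (sum-*ˡ m _ _))) ⟩
      sumF m (λ t → sumF m (λ v → sumF m (λ u → (x t * F t v) * (g u * X u v))))
        ≈⟨ trans (sum-cong m (λ t → sum-swap m m _)) (sum-swap m m _) ⟩
      sumF m (λ u → sumF m (λ t → sumF m (λ v → (x t * F t v) * (g u * X u v))))
        ≈⟨ sum-cong m (λ u → sum-cong m (λ t → sum-cong m (λ v →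
             solve 4 (λ a b c d → ((a :* b) :* (c :* d)) := (c :* ((a :* b) :* d))) refl _ _ _ _))) ⟩
      sumF m (λ u → sumF m (λ t → sumF m (λ v → g u * ((x t * F t v) * X u v))))
        ≈⟨ sum-cong m (λ u → trans (sum-cong m (λ t → sum-*ˡ m _ _)) (sum-*ˡ m _ _)) ⟩
      sumF m (λ u → g u * β F x (X u)) ∎

    conj-· : ∀ (Q P F : Mat m) → conj Q (conj P F) ≋ conj (Q · P) F
    conj-· Q P F a b = sym (begin
      β F ((Q · P) a) ((Q · P) b)
        ≈⟨ β-linearˡ F (Q a) P _ ⟩
      sumF m (λ u → Q a u * β F (P u) ((Q · P) b))
        ≈⟨ sum-cong m (λ u → *-congˡ (β-linearʳ F (P u) (Q b) P)) ⟩
      sumF m (λ u → Q a u * sumF m (λ v → Q b v * β F (P u) (P v)))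
        ≈⟨ sum-cong m (λ u → trans (sym (sum-*ˡ m _ _)) (sum-cong m (λ v →
             solve 3 (λ a b c → (a :* (b :* c)) := ((a :* c) :* b)) refl _ _ _))) ⟩
      β (conj P F) (Q a) (Q b) ∎)

    conj-as-product : ∀ (P B : Mat m) → conj P B ≋ (P · B) · P ᵀ
    conj-as-product P B a b =
      trans (sum-swap m m _) (sum-cong m (λ v → sum-*ʳ m _ _))

    conj-scale : ∀ (P A : Mat m) x → conj P (λ i j → x * A i j) ≋ (λ i j → x * conj P A i j)
    conj-scale P A x a b = begin
      sumF m (λ u → sumF m (λ v → (P a u * (x * A u v)) * P b v))
        ≈⟨ sum-cong m (λ u → sum-cong m (λ v →
             solve 4 (λ p q x y → ((p :* (x :* y)) :* q) := (x :* ((p :* y) :* q))) refl _ _ _ _)) ⟩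
      sumF m (λ u → sumF m (λ v → x * ((P a u * A u v) * P b v)))
        ≈⟨ trans (sum-cong m (λ u → sum-*ˡ m _ _)) (sum-*ˡ m _ _) ⟩
      x * conj P A a b ∎

    conj-zero : ∀ (P : Mat m) → conj P zeroMat ≋ zeroMat
    conj-zero P i j = sum-zero m (λ u → sum-zero m (λ v → trans (*-congʳ (zeroʳ _)) (zeroˡ _)))

    tr-cong : ∀ {F F′ A A′ : Mat m} → F ≋ F′ → A ≋ A′ → tr F A ≈ tr F′ A′
    tr-cong F≋ A≋ = sum-cong m (λ i → sum-cong m (λ j → *-cong (F≋ i j) (A≋ j i)))

    tr-conj : ∀ (P G A : Mat m) → tr (conj P G) A ≈ tr G (conj (P ᵀ) A)
    tr-conj P G A = begin
      sumF m (λ i → sumF m (λ j → β G (P i) (P j) * A j i))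
        ≈⟨ sum-cong m (λ i → sum-cong m (λ j →
             trans (sym (sum-*ʳ m _ _)) (sum-cong m (λ u → sym (sum-*ʳ m _ _))))) ⟩
      sumF m (λ i → sumF m (λ j → sumF m (λ u → sumF m (λ v → ((P i u * G u v) * P j v) * A j i))))
        ≈⟨ reorder ⟩
      sumF m (λ u → sumF m (λ v → sumF m (λ j → sumF m (λ i → ((P i u * G u v) * P j v) * A j i))))
        ≈⟨ sum-cong m (λ u → sum-cong m (λ v → sum-cong m (λ j → sum-cong m (λ i →
             solve 4 (λ a b c d → (((a :* b) :* c) :* d) := (b :* ((c :* d) :* a))) refl
               (P i u) (G u v) (P j v) (A j i))))) ⟩
      sumF m (λ u → sumF m (λ v → sumF m (λ j → sumF m (λ i → G u v * ((P j v * A j i) * P i u)))))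
        ≈⟨ sum-cong m (λ u → sum-cong m (λ v → trans (sum-cong m (λ j → sum-*ˡ m _ _)) (sum-*ˡ m _ _))) ⟩
      sumF m (λ u → sumF m (λ v → G u v * β A (λ j → P j v) (λ i → P i u))) ∎
      where
        reorder : ∀ {g : Fin m → Fin m → Fin m → Fin m → Carrier} →
          sumF m (λ i → sumF m (λ j → sumF m (λ u → sumF m (λ v → g i j u v)))) ≈
          sumF m (λ u → sumF m (λ v → sumF m (λ j → sumF m (λ i → g i j u v))))
        reorder = begin
          _ ≈⟨ sum-cong m (λ i → sum-swap m m _) ⟩
          _ ≈⟨ sum-swap m m _ ⟩
          _ ≈⟨ sum-cong m (λ u → sum-cong m (λ i → sum-swap m m _)) ⟩
          _ ≈⟨ sum-cong m (λ u → sum-swap m m _) ⟩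
          _ ≈⟨ sum-cong m (λ u → sum-cong m (λ v → sum-swap m m _)) ⟩
          _ ∎

    Skew-cong : ∀ {A B : Mat m} → A ≋ B → Skew A → Skew B
    Skew-cong A≋B (anti , diag) =
      (λ i j → trans (sym (A≋B j i)) (trans (anti i j) (-‿cong (A≋B i j)))) ,
      (λ i → trans (sym (A≋B i i)) (diag i))

    β-antisym : ∀ {F : Mat m} → Skew F → ∀ x y → β F y x ≈ - β F x y
    β-antisym {F} (anti , _) x y = begin
      sumF m (λ u → sumF m (λ v → (y u * F u v) * x v))
        ≈⟨ sum-swap m m _ ⟩
      sumF m (λ v → sumF m (λ u → (y u * F u v) * x v))
        ≈⟨ sum-cong m (λ v → sum-cong m (λ u → entry v u)) ⟩
      sumF m (λ v → sumF m (λ u → - ((x v * F v u) * y u)))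
        ≈⟨ trans (sum-cong m (λ v → sum-neg m _)) (sum-neg m _) ⟩
      - β F x y ∎
      where
        entry : ∀ v u → (y u * F u v) * x v ≈ - ((x v * F v u) * y u)
        entry v u = begin
          (y u * F u v) * x v      ≈⟨ *-congʳ (*-congˡ (anti v u)) ⟩
          (y u * - F v u) * x v    ≈⟨ *-congʳ (sym (-‿distribʳ-* _ _)) ⟩
          - (y u * F v u) * x v    ≈⟨ sym (-‿distribˡ-* _ _) ⟩
          - ((y u * F v u) * x v)  ≈⟨ -‿cong (solve 3 (λ a b c → ((a :* b) :* c) := ((c :* b) :* a)) refl _ _ _) ⟩
          - ((x v * F v u) * y u)  ∎

    β-alternating : ∀ {F : Mat m} → Skew F → ∀ x → β F x x ≈ 0#
    β-alternating {F} (anti , diag) x = sum-alternating m (λ u v → (x u * F u v) * x v)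
      (λ u v → trans (*-congʳ (*-congˡ (anti u v))) (begin
         (x v * - F u v) * x u    ≈⟨ *-congʳ (sym (-‿distribʳ-* _ _)) ⟩
         - (x v * F u v) * x u    ≈⟨ sym (-‿distribˡ-* _ _) ⟩
         - ((x v * F u v) * x u)  ≈⟨ -‿cong (solve 3 (λ a b c → ((a :* b) :* c) := ((c :* b) :* a)) refl _ _ _) ⟩
         - ((x u * F u v) * x v)  ∎))
      (λ u → trans (*-congʳ (trans (*-congˡ (diag u)) (zeroʳ _))) (zeroˡ _))

    conj-skew : ∀ (P : Mat m) {F : Mat m} → Skew F → Skew (conj P F)
    conj-skew P skew = (λ i j → β-antisym skew (P i) (P j)) , (λ i → β-alternating skew (P i))

  Congruent : ∀ {m} → Mat m → Mat m → Set (c ⊔ ℓ)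
  Congruent {m} G H = Σ (Mat m) λ P → Σ (Mat m) λ Q →
    (P · Q ≋ I) × (Q · P ≋ I) × (H ≋ conj P G)

  module _ {m : ℕ} where
    Congruent-reflexive : ∀ {G H : Mat m} → G ≋ H → Congruent G H
    Congruent-reflexive {G} G≋H =
      I , I , ·-identityˡ I , ·-identityˡ I , ≋-trans (≋-sym G≋H) (≋-sym (conj-I G))

    Congruent-inverse : ∀ {G H : Mat m} → ((P , Q , _) : Congruent G H) → G ≋ conj Q H
    Congruent-inverse {G} (P , Q , PQ , QP , H≋) =
      ≋-sym (≋-trans (conj-cong ≋-refl H≋)
              (≋-trans (conj-· Q P G) (≋-trans (conj-cong QP ≋-refl) (conj-I G))))

    Congruent-sym : ∀ {G H : Mat m} → Congruent G H → Congruent H G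
    Congruent-sym C@(P , Q , PQ , QP , _) = Q , P , QP , PQ , Congruent-inverse C

    Congruent-trans : ∀ {G H K : Mat m} → Congruent G H → Congruent H K → Congruent G K
    Congruent-trans {G} (P , Q , PQ , QP , H≋) (P′ , Q′ , PQ′ , QP′ , K≋) =
      P′ · P , Q · Q′ , inverse-· P′ P Q Q′ PQ PQ′ , inverse-· Q Q′ P′ P QP′ QP ,
      ≋-trans K≋ (≋-trans (conj-cong ≋-refl H≋) (conj-· P′ P G))
      where
        inverse-· : ∀ A B C D → B · C ≋ I → A · D ≋ I → (A · B) · (C · D) ≋ I
        inverse-· A B C D BC AD =
          ≋-trans (·-assoc A B _) (≋-trans (·-cong ≋-refl (≋-sym (·-assoc B C D)))
            (≋-trans (·-cong ≋-refl (·-cong BC ≋-refl)) (≋-trans (·-cong ≋-refl (·-identityˡ D)) AD)))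

    Congruent-skew : ∀ {G H : Mat m} → Congruent G H → Skew G → Skew H
    Congruent-skew (P , _ , _ , _ , H≋) skew = Skew-cong (≋-sym H≋) (conj-skew P skew)

module Rank {c ℓ} (𝔽 : FiniteField c ℓ) where
  open FiniteField 𝔽 hiding (zero)
  open FF 𝔽
  open Sums 𝔽
  open Matrices 𝔽
  open import Relation.Binary.Reasoning.Setoid setoid
  open import Algebra.Properties.Ring ring using (-‿distribˡ-*; -‿distribʳ-*; -‿involutive)
  open import Algebra.Properties.AbelianGroup +-abelianGroup using (inverseˡ-unique)
  open import Algebra.Solver.Ring.NaturalCoefficients.Default commutativeSemiring
    using (solve; _:*_; _:=_)

  private
    module Scalars = Enumeration _≈_ elements complete
    module Indices (m : ℕ) = Enumeration _≡_ (allFin m) ∈-allFin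

  LinRel : ∀ {k m} → (Fin k → Fin m → Carrier) → (Fin k → Carrier) → Set ℓ
  LinRel {k} v a = ∀ j → sumF k (λ i → a i * v i j) ≈ 0#

  LinRel-resp : ∀ {k m} {v w : Fin k → Fin m → Carrier} {a b : Fin k → Carrier} →
    (∀ i j → v i j ≈ w i j) → (∀ i → a i ≈ b i) → LinRel v a → LinRel w b
  LinRel-resp v≈w a≈b rel j =
    trans (sum-cong _ (λ i → *-cong (sym (a≈b i)) (sym (v≈w i j)))) (rel j)

  LinIndep-cong : ∀ {k m} {v w : Fin k → Fin m → Carrier} →
    (∀ i j → v i j ≈ w i j) → LinIndep v → LinIndep w
  LinIndep-cong v≈w indep a rel = indep a (LinRel-resp (λ i j → sym (v≈w i j)) (λ _ → refl) rel)

  private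
    AllZero : ∀ {k} → (Fin k → Carrier) → Set ℓ
    AllZero a = ∀ i → a i ≈ 0#

    LinRel? : ∀ {k m} (v : Fin k → Fin m → Carrier) a → Dec (LinRel v a)
    LinRel? v a = Finₚ.all? (λ j → _ ≟ 0#)

    AllZero? : ∀ {k} (a : Fin k → Carrier) → Dec (AllZero a)
    AllZero? a = Finₚ.all? (λ i → a i ≟ 0#)

  -- over a finite field, independence is decided by trying all coefficients
  LinIndep? : ∀ {k m} (v : Fin k → Fin m → Carrier) → Dec (LinIndep v)
  LinIndep? v = Scalars.all? (λ a → LinRel v a → AllZero a) (λ a → LinRel? v a →-dec AllZero? a)
    (λ a≈b indep rel i → trans (a≈b i) (indep (LinRel-resp (λ _ _ → refl) a≈b rel) i))

  dependence : ∀ {k m} (v : Fin k → Fin m → Carrier) → ¬ LinIndep v →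
    ∃ λ a → LinRel v a × ∃ λ i → ¬ (a i ≈ 0#)
  dependence {k} v ¬indep with Scalars.any? (λ a → LinRel v a × ¬ AllZero a)
      (λ a → LinRel? v a ×-dec ¬? (AllZero? a))
      (λ a≈b (rel , ¬zero) → LinRel-resp (λ _ _ → refl) a≈b rel , λ b≈0 → ¬zero (λ i → trans (a≈b i) (b≈0 i)))
  ... | yes (a , rel , ¬zero) = a , rel , Finₚ.¬∀⟶∃¬ k _ (λ i → a i ≟ 0#) ¬zero
  ... | no ¬nontrivial = ⊥-elim (¬indep λ a rel → trivial a rel)
    where
      trivial : ∀ a → LinRel v a → AllZero a
      trivial a rel with AllZero? a
      ... | yes all-zero = all-zero
      ... | no ¬zero = ⊥-elim (¬nontrivial (a , rel , ¬zero))

  RankLe? : ∀ {m} (A : Mat m) s → Dec (RankLe A s)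
  RankLe? {m} A s = Indices.all? m (λ σ → ¬ LinIndep (λ i → A (σ i))) (λ σ → ¬? (LinIndep? (λ i → A (σ i))))
    (λ σ≡τ ¬indep indep → ¬indep (LinIndep-cong (λ i j → reflexive (≡.cong (λ r → A r j) (σ≡τ i))) indep))

  RankLe-cong : ∀ {m} {A A′ : Mat m} {s} → A ≋ A′ → RankLe A s → RankLe A′ s
  RankLe-cong A≋A′ rank σ indep = rank σ (LinIndep-cong (λ i j → sym (A≋A′ (σ i) j)) indep)

  -- Gaussian elimination: n vectors in F^s with s < n are linearly dependent
  dependent-if-many : ∀ s n → s ℕ.< n → (C : Fin n → Fin s → Carrier) →
    ∃ λ a → (∃ λ i → ¬ (a i ≈ 0#)) × LinRel C a
  dependent-if-many zero    (suc n) _ C = (λ _ → 1#) , (zero , λ 1≈0 → 0≉1 (sym 1≈0)) , (λ ())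
  dependent-if-many (suc s) (suc n) (s≤s s<n) C with Finₚ.all? (λ i → C i zero ≟ 0#)
  ... | yes column₀≈0 =
    let (a′ , (i , a′i≉0) , rel′) = dependent-if-many s n s<n (λ i j → C (suc i) (suc j))
    in (Vector._∷_ 0# a′) , (suc i , a′i≉0) , λ
      { zero    → trans (+-cong (zeroˡ _) (sum-zero n (λ i → trans (*-congˡ (column₀≈0 (suc i))) (zeroʳ _))))
                        (+-identityʳ 0#)
      ; (suc j) → trans (+-cong (zeroˡ _) (rel′ j)) (+-identityʳ 0#) }
  ... | no ¬column₀≈0 with Finₚ.¬∀⟶∃¬ (suc n) _ (λ i → C i zero ≟ 0#) ¬column₀≈0
  ... | p , pivot≉0 with inverse (C p zero) pivot≉0
  ... | d , pivot*d≈1 =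
    let (a′ , (i , a′i≉0) , rel′) = dependent-if-many s n s<n reduced
    in a a′ , (punchIn p i , λ ai≈0 → a′i≉0 (trans (sym (a-punchIn a′ i)) ai≈0)) , relation a′ rel′
    where
      -- the other rows, and the same rows with their first entry cleared by row p
      row : Fin n → Fin (suc s) → Carrier
      row i = C (punchIn p i)
      reduced : Fin n → Fin s → Carrier
      reduced i j = row i (suc j) + - ((row i zero * d) * C p (suc j))

      -- the relation a′ among the reduced rows, completed by a coefficient for row p
      a : (Fin n → Carrier) → Fin (suc n) → Carrier
      a a′ = Vector.insertAt a′ p (- (sumF n (λ i → a′ i * row i zero) * d))

      a-punchIn : ∀ a′ i → a a′ (punchIn p i) ≈ a′ i
      a-punchIn a′ i = reflexive (insertAt-punchIn a′ p _ i)

      split : ∀ a′ j → sumF (suc n) (λ x → a a′ x * C x j) ≈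
        - (sumF n (λ i → a′ i * row i zero) * d) * C p j + sumF n (λ i → a′ i * row i j)
      split a′ j = trans (sum-punchIn n p (λ x → a a′ x * C x j))
        (+-cong (*-congʳ (reflexive (insertAt-lookup a′ p _))) (sum-cong n (λ i → *-congʳ (a-punchIn a′ i))))

      cancel : ∀ x j → - (x * d) * C p j + x * (d * C p j) ≈ 0#
      cancel x j = trans (+-congʳ (trans (sym (-‿distribˡ-* _ _)) (-‿cong (*-assoc _ _ _)))) (-‿inverseˡ _)

      relation : ∀ a′ → LinRel reduced a′ → LinRel C (a a′)
      relation a′ rel′ zero = trans (split a′ zero) (begin
        - (S * d) * C p zero + S
          ≈⟨ +-congˡ (sym (trans (*-congˡ (trans (*-comm _ _) pivot*d≈1)) (*-identityʳ S))) ⟩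
        - (S * d) * C p zero + S * (d * C p zero)
          ≈⟨ cancel S zero ⟩
        0# ∎)
        where S = sumF n (λ i → a′ i * row i zero)
      relation a′ rel′ (suc j) = trans (split a′ (suc j)) (begin
        - (S * d) * C p (suc j) + sumF n (λ i → a′ i * row i (suc j))
          ≈⟨ +-congˡ (inverseˡ-unique _ _ (trans (sym expand) (rel′ j))) ⟩
        - (S * d) * C p (suc j) + - - sumF n (λ i → a′ i * ((row i zero * d) * C p (suc j)))
          ≈⟨ +-congˡ (trans (-‿involutive _) collect) ⟩
        - (S * d) * C p (suc j) + S * (d * C p (suc j))
          ≈⟨ cancel S (suc j) ⟩
        0# ∎)
        where
          S = sumF n (λ i → a′ i * row i zero)
          expand : sumF n (λ i → a′ i * reduced i j) ≈
            sumF n (λ i → a′ i * row i (suc j)) + - sumF n (λ i → a′ i * ((row i zero * d) * C p (suc j)))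
          expand = trans (sum-cong n (λ i → trans (distribˡ _ _ _) (+-congˡ (sym (-‿distribʳ-* _ _)))))
                     (trans (sum-+ n _ _) (+-congˡ (sum-neg n _)))
          collect : sumF n (λ i → a′ i * ((row i zero * d) * C p (suc j))) ≈ S * (d * C p (suc j))
          collect = trans (sum-cong n (λ i →
                      solve 4 (λ a b c e → (a :* ((b :* c) :* e)) := ((a :* b) :* (c :* e))) refl _ _ _ _))
                      (sum-*ʳ n _ _)

  module _ {m : ℕ} (A : Mat m) where
    IndepRows : ℕ → Set (c ⊔ ℓ)
    IndepRows k = ∃ λ (ρ : Fin k → Fin m) → LinIndep (λ i → A (ρ i))

    IndepRows? : ∀ k → Dec (IndepRows k)
    IndepRows? k = Indices.any? m (λ ρ → LinIndep (λ i → A (ρ i))) (λ ρ → LinIndep? (λ i → A (ρ i)))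
      (λ σ≡τ indep → LinIndep-cong (λ i j → reflexive (≡.cong (λ r → A r j) (σ≡τ i))) indep)

    maximal-indep : ∀ n → ¬ IndepRows (suc n) → ∃ λ k → k ℕ.≤ n × IndepRows k × ¬ IndepRows (suc k)
    maximal-indep n none with IndepRows? n
    ... | yes rows = n , ℕₚ.≤-refl , rows , none
    maximal-indep zero    none | no ¬rows = ⊥-elim (¬rows ((λ ()) , λ a rel ()))
    maximal-indep (suc n) none | no ¬rows =
      let (k , k≤n , rows , maximal) = maximal-indep n ¬rows
      in k , ℕₚ.m≤n⇒m≤1+n k≤n , rows , maximal

    spans : ∀ {k} → ((ρ , _) : IndepRows k) → ¬ IndepRows (suc k) →
      ∀ l → ∃ λ (x : Fin k → Carrier) → ∀ j → A l j ≈ sumF k (λ i → x i * A (ρ i) j)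
    spans {k} (ρ , indep) maximal l
      with dependence (λ i → A (Vector._∷_ l ρ i)) (λ indep′ → maximal (Vector._∷_ l ρ , indep′))
    ... | a , rel , i₀ , ai₀≉0 with a zero ≟ 0#
    ... | yes a₀≈0 = ⊥-elim (ai₀≉0 (all-zero i₀))
      where
        all-zero : ∀ i → a i ≈ 0#
        all-zero zero    = a₀≈0
        all-zero (suc i) = indep (λ i → a (suc i))
          (λ j → trans (sym (+-identityˡ _)) (trans (+-congʳ (sym (trans (*-congʳ a₀≈0) (zeroˡ _)))) (rel j))) i
    ... | no a₀≉0 with inverse (a zero) a₀≉0
    ... | b , a₀b≈1 = (λ i → - (b * a (suc i))) , λ j → sym (begin
      sumF k (λ i → - (b * a (suc i)) * A (ρ i) j)
        ≈⟨ sum-cong k (λ i → trans (sym (-‿distribˡ-* _ _)) (-‿cong (*-assoc _ _ _))) ⟩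
      sumF k (λ i → - (b * (a (suc i) * A (ρ i) j)))
        ≈⟨ trans (sum-neg k _) (-‿cong (sum-*ˡ k _ _)) ⟩
      - (b * sumF k (λ i → a (suc i) * A (ρ i) j))
        ≈⟨ -‿cong (*-congˡ (inverseˡ-unique _ _ (trans (+-comm _ _) (rel j)))) ⟩
      - (b * - (a zero * A l j))
        ≈⟨ trans (-‿cong (sym (-‿distribʳ-* _ _))) (-‿involutive _) ⟩
      b * (a zero * A l j)
        ≈⟨ trans (sym (*-assoc _ _ _)) (*-congʳ (trans (*-comm _ _) a₀b≈1)) ⟩
      1# * A l j
        ≈⟨ *-identityˡ _ ⟩
      A l j ∎)

  -- rows of B Q are the rows of B transformed linearly, so relations persist
  RankLe-·ʳ : ∀ {m} (B Q : Mat m) s → RankLe B s → RankLe (B · Q) s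
  RankLe-·ʳ {m} B Q s rank σ indep = rank σ λ a rel → indep a λ j → begin
    sumF (suc s) (λ i → a i * sumF m (λ l → B (σ i) l * Q l j))
      ≈⟨ sum-cong (suc s) (λ i → trans (sym (sum-*ˡ m (a i) _)) (sum-cong m (λ l → sym (*-assoc (a i) (B (σ i) l) (Q l j))))) ⟩
    sumF (suc s) (λ i → sumF m (λ l → (a i * B (σ i) l) * Q l j))
      ≈⟨ sum-swap (suc s) m (λ i l → (a i * B (σ i) l) * Q l j) ⟩
    sumF m (λ l → sumF (suc s) (λ i → (a i * B (σ i) l) * Q l j))
      ≈⟨ sum-zero m (λ l → trans (sum-*ʳ (suc s) (Q l j) (λ i → a i * B (σ i) l)) (trans (*-congʳ (rel l)) (zeroˡ _))) ⟩
    0# ∎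

  -- rows of P B are combinations of the k ≤ s rows spanning B, and more than
  -- k such combinations are dependent
  RankLe-·ˡ : ∀ {m} (P B : Mat m) s → RankLe B s → RankLe (P · B) s
  RankLe-·ˡ {m} P B s rank σ indep = a≉0 (indep a relation i₀)
    where
      bounded = maximal-indep B s (λ (ρ , indep) → rank ρ indep)
      k = proj₁ bounded
      k≤s = proj₁ (proj₂ bounded)
      rows = proj₁ (proj₂ (proj₂ bounded))
      ρ = proj₁ rows
      X : Fin m → Fin k → Carrier
      X l = proj₁ (spans B rows (proj₂ (proj₂ (proj₂ bounded))) l)
      X-spans : ∀ l j → B l j ≈ sumF k (λ i → X l i * B (ρ i) j)
      X-spans l = proj₂ (spans B rows (proj₂ (proj₂ (proj₂ bounded))) l)
      coords : Fin (suc s) → Fin k → Carrier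
      coords i j = sumF m (λ l → P (σ i) l * X l j)
      kernel = dependent-if-many k (suc s) (s≤s k≤s) coords
      a = proj₁ kernel
      i₀ = proj₁ (proj₁ (proj₂ kernel))
      a≉0 = proj₂ (proj₁ (proj₂ kernel))
      regroup : ∀ {n₁ n₂} (x : Fin n₁ → Carrier) (y : Fin n₁ → Fin n₂ → Carrier) (z : Fin n₂ → Carrier) →
        sumF n₁ (λ u → x u * sumF n₂ (λ v → y u v * z v)) ≈ sumF n₂ (λ v → sumF n₁ (λ u → x u * y u v) * z v)
      regroup {n₁} {n₂} x y z =
        trans (sum-cong n₁ (λ u → trans (sym (sum-*ˡ n₂ _ _)) (sum-cong n₂ (λ v → sym (*-assoc _ _ _)))))
          (trans (sum-swap n₁ n₂ (λ u v → (x u * y u v) * z v)) (sum-cong n₂ (λ v → sum-*ʳ n₁ (z v) (λ u → x u * y u v))))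
      relation : LinRel (λ i → (P · B) (σ i)) a
      relation col = begin
        sumF (suc s) (λ i → a i * sumF m (λ l → P (σ i) l * B l col))
          ≈⟨ sum-cong (suc s) (λ i → *-congˡ {a i} (trans (sum-cong m (λ l → *-congˡ {P (σ i) l} (X-spans l col)))
                                                     (regroup (P (σ i)) X (λ j → B (ρ j) col)))) ⟩
        sumF (suc s) (λ i → a i * sumF k (λ j → coords i j * B (ρ j) col))
          ≈⟨ regroup a coords (λ j → B (ρ j) col) ⟩
        sumF k (λ j → sumF (suc s) (λ i → a i * coords i j) * B (ρ j) col)
          ≈⟨ sum-zero k (λ j → trans (*-congʳ (proj₂ (proj₂ kernel) j)) (zeroˡ _)) ⟩
        0# ∎

  RankLe-conj : ∀ {m} (P B : Mat m) s → RankLe B s → RankLe (conj P B) s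
  RankLe-conj P B s rank =
    RankLe-cong (≋-sym (conj-as-product P B)) (RankLe-·ʳ (P · B) (P ᵀ) s (RankLe-·ˡ P B s rank))

  RankLe-Congruent : ∀ {m} {G H : Mat m} → Congruent G H → ∀ s → RankLe G s → RankLe H s
  RankLe-Congruent {G = G} (P , _ , _ , _ , H≋) s rank = RankLe-cong (≋-sym H≋) (RankLe-conj P G s rank)

  RankLe-scale : ∀ {m} x (B : Mat m) s → RankLe B s → RankLe (λ i j → x * B i j) s
  RankLe-scale x B s rank σ indep = rank σ λ a rel → indep a λ j →
    trans (sum-cong (suc s) (λ i → solve 3 (λ a x b → a :* (x :* b) := x :* (a :* b)) refl (a i) x (B (σ i) j)))
      (trans (sum-*ˡ (suc s) x (λ i → a i * B (σ i) j)) (trans (*-congˡ (rel j)) (zeroʳ x)))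

  indep-subfamily : ∀ {r m} (v : Fin r → Fin m → Carrier) → LinIndep v → ∀ s → s ℕ.< r →
    ∃ λ (σ : Fin (suc s) → Fin r) → LinIndep (λ i → v (σ i))
  indep-subfamily {suc r} v indep s (s≤s s≤r) with s ℕ.≟ r
  ... | yes ≡.refl = (λ i → i) , indep
  ... | no s≢r =
    let (σ , indep′) = indep-subfamily (λ i → v (suc i)) tail-indep s (ℕₚ.≤∧≢⇒< s≤r s≢r)
    in (λ i → suc (σ i)) , indep′
    where
      tail-indep : LinIndep (λ i → v (suc i))
      tail-indep a rel i = indep (Vector._∷_ 0# a) (λ j → trans (+-cong (zeroˡ _) (rel j)) (+-identityʳ 0#)) (suc i)

  rank-lower-bound : ∀ {m r} (A : Mat m) (ρ : Fin r → Fin m) → LinIndep (λ i → A (ρ i)) →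
    ∀ s → RankLe A s → r ℕ.≤ s
  rank-lower-bound {r = r} A ρ indep s rank with r ℕ.≤? s
  ... | yes r≤s = r≤s
  ... | no r≰s =
    let (σ , indep′) = indep-subfamily (λ i → A (ρ i)) indep s (ℕₚ.≰⇒> r≰s)
    in ⊥-elim (rank (λ i → ρ (σ i)) indep′)

module NormalForm {c ℓ} (𝔽 : FiniteField c ℓ) where
  open FiniteField 𝔽 hiding (zero)
  open FF 𝔽
  open Sums 𝔽
  open Matrices 𝔽
  open Rank 𝔽
  open import Algebra.Properties.Ring ring using (-0#≈0#; -‿involutive; -1*x≈-x)

  blockJ : ∀ {m} → Mat m → Mat (suc (suc m))
  blockJ X zero          zero          = 0#
  blockJ X zero          (suc zero)    = 1#
  blockJ X zero          (suc (suc j)) = 0#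
  blockJ X (suc zero)    zero          = - 1#
  blockJ X (suc zero)    (suc j)       = 0#
  blockJ X (suc (suc i)) zero          = 0#
  blockJ X (suc (suc i)) (suc zero)    = 0#
  blockJ X (suc (suc i)) (suc (suc j)) = X i j

  blockJ-cong : ∀ {m} {X Y : Mat m} → X ≋ Y → blockJ X ≋ blockJ Y
  blockJ-cong X≋Y zero          zero          = refl
  blockJ-cong X≋Y zero          (suc zero)    = refl
  blockJ-cong X≋Y zero          (suc (suc j)) = refl
  blockJ-cong X≋Y (suc zero)    zero          = refl
  blockJ-cong X≋Y (suc zero)    (suc j)       = refl
  blockJ-cong X≋Y (suc (suc i)) zero          = refl
  blockJ-cong X≋Y (suc (suc i)) (suc zero)    = refl
  blockJ-cong X≋Y (suc (suc i)) (suc (suc j)) = X≋Y i j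

  -- Nf k m = J ⊕ ⋯ ⊕ J ⊕ 0 with k blocks J (as many as fit in m)
  Nf : ℕ → (m : ℕ) → Mat m
  Nf zero    m             = zeroMat
  Nf (suc k) zero          = zeroMat
  Nf (suc k) (suc zero)    = zeroMat
  Nf (suc k) (suc (suc m)) = blockJ (Nf k m)

  Nf-zero-row : ∀ k m (a : Fin m) → k ℕ.* 2 ℕ.≤ toℕ a → ∀ b → Nf k m a b ≈ 0#
  Nf-zero-row zero    m             a             _               b             = refl
  Nf-zero-row (suc k) (suc zero)    a             _               b             = refl
  Nf-zero-row (suc k) (suc (suc m)) (suc (suc a)) (s≤s (s≤s 2k≤a)) zero          = refl
  Nf-zero-row (suc k) (suc (suc m)) (suc (suc a)) (s≤s (s≤s 2k≤a)) (suc zero)    = refl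
  Nf-zero-row (suc k) (suc (suc m)) (suc (suc a)) (s≤s (s≤s 2k≤a)) (suc (suc b)) = Nf-zero-row k m a 2k≤a b

  -- among any 2k+1 rows either one vanishes or two coincide
  Nf-RankLe : ∀ k m → RankLe (Nf k m) (k ℕ.* 2)
  Nf-RankLe k m σ indep with Finₚ.any? (λ i → k ℕ.* 2 ℕ.≤? toℕ (σ i))
  ... | yes (i , 2k≤σi) = 0≉1 (sym (trans (sym (δ-same i)) (indep (δ i) zero-row i)))
    where
      zero-row : LinRel (λ l → Nf k m (σ l)) (δ i)
      zero-row col = trans (sum-δˡ _ i (λ l → Nf k m (σ l) col)) (Nf-zero-row k m (σ i) 2k≤σi col)
  ... | no none = 0≉1 (sym (trans (sym coefficient) (indep (λ l → δ i l + - δ j l) equal-rows i)))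
    where
      below : ∀ i → toℕ (σ i) ℕ.< k ℕ.* 2
      below i = ℕₚ.≰⇒> (λ 2k≤σi → none (i , 2k≤σi))
      pigeon = Finₚ.pigeonhole ℕₚ.≤-refl (λ i → fromℕ< (below i))
      i = proj₁ pigeon
      j = proj₁ (proj₂ pigeon)
      σi≡σj : σ i ≡ σ j
      σi≡σj = Finₚ.toℕ-injective (≡.trans (≡.sym (Finₚ.toℕ-fromℕ< (below i)))
        (≡.trans (≡.cong toℕ (proj₂ (proj₂ (proj₂ pigeon)))) (Finₚ.toℕ-fromℕ< (below j))))
      equal-rows : LinRel (λ l → Nf k m (σ l)) (λ l → δ i l + - δ j l)
      equal-rows col = trans (sum-δ-δ _ i j (λ l → Nf k m (σ l) col))
        (trans (+-congʳ (reflexive (≡.cong (λ r → Nf k m r col) σi≡σj))) (-‿inverseʳ _))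
      coefficient : δ i i + - δ j i ≈ 1#
      coefficient = trans (+-cong (δ-same i)
        (trans (-‿cong (δ-diff (λ j≡i → Finₚ.<⇒≢ (proj₁ (proj₂ (proj₂ pigeon))) (≡.sym j≡i)))) -0#≈0#))
        (+-identityʳ _)

  Nf-rows : ∀ k m → k ℕ.* 2 ℕ.≤ m → Fin (k ℕ.* 2) → Fin m
  Nf-rows (suc k) (suc (suc m)) (s≤s (s≤s 2k≤m)) zero          = zero
  Nf-rows (suc k) (suc (suc m)) (s≤s (s≤s 2k≤m)) (suc zero)    = suc zero
  Nf-rows (suc k) (suc (suc m)) (s≤s (s≤s 2k≤m)) (suc (suc i)) = suc (suc (Nf-rows k m 2k≤m i))

  Nf-indep : ∀ k m (2k≤m : k ℕ.* 2 ℕ.≤ m) → LinIndep (λ i → Nf k m (Nf-rows k m 2k≤m i))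
  Nf-indep zero    m             _               a rel ()
  Nf-indep (suc k) (suc (suc m)) (s≤s (s≤s 2k≤m)) a rel = all-zero
    where
      two-terms : ∀ x y → a zero * x + (a (suc zero) * y + sumF (k ℕ.* 2) (λ i → a (suc (suc i)) * 0#))
                          ≈ a zero * x + a (suc zero) * y
      two-terms x y = +-congˡ (trans (+-congˡ (sum-zero (k ℕ.* 2) (λ i → zeroʳ (a (suc (suc i)))))) (+-identityʳ _))
      a₀≈0 : a zero ≈ 0#
      a₀≈0 = trans (sym (trans (two-terms 1# 0#) (trans (+-cong (*-identityʳ _) (zeroʳ _)) (+-identityʳ _))))
                   (rel (suc zero))
      a₁≈0 : a (suc zero) ≈ 0#
      a₁≈0 = trans (sym (-‿involutive _)) (trans (-‿cong -a₁≈0) -0#≈0#)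
        where
          -a₁≈0 : - a (suc zero) ≈ 0#
          -a₁≈0 = trans (sym (trans (two-terms 0# (- 1#))
                    (trans (+-cong (zeroʳ _) (trans (*-comm _ _) (-1*x≈-x _))) (+-identityˡ _))))
                    (rel zero)
      all-zero : ∀ i → a i ≈ 0#
      all-zero zero          = a₀≈0
      all-zero (suc zero)    = a₁≈0
      all-zero (suc (suc i)) = Nf-indep k m 2k≤m (λ i → a (suc (suc i)))
        (λ j → trans (sym (trans (+-cong (zeroʳ _) (+-cong (zeroʳ _) refl)) (trans (+-identityˡ _) (+-identityˡ _))))
                     (rel (suc (suc j)))) i

  rank-of-normal-form : ∀ {m} (F : Mat m) r k → HasRank F r →
    Congruent F (Nf k m) → k ℕ.* 2 ℕ.≤ m → r ≡ k ℕ.* 2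
  rank-of-normal-form {m} F r k ((ρ , indep) , rank) F∼Nf 2k≤m = ℕₚ.≤-antisym
    (rank-lower-bound F ρ indep (k ℕ.* 2) (RankLe-Congruent (Congruent-sym F∼Nf) (k ℕ.* 2) (Nf-RankLe k m)))
    (rank-lower-bound (Nf k m) (Nf-rows k m 2k≤m) (Nf-indep k m 2k≤m) r (RankLe-Congruent F∼Nf r rank))

-- Every skew-symmetric matrix is congruent to a normal form Nf k m:
-- permute a nonzero entry to position (0,1), scale it to 1, clear the
-- rest of the first two rows and columns, and recurse on the remaining
-- (m-2)×(m-2) block.
module Reduction {c ℓ} (𝔽 : FiniteField c ℓ) where
  open FiniteField 𝔽 hiding (zero)
  open FF 𝔽
  open Sums 𝔽
  open Matrices 𝔽
  open NormalForm 𝔽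
  open import Relation.Binary.Reasoning.Setoid setoid
  open import Algebra.Properties.Ring ring using (-0#≈0#; -1*x≈-x)
  open import Algebra.Solver.Ring.NaturalCoefficients.Default commutativeSemiring
    using (solve; _:+_; _:*_; _:=_)

  module _ {m : ℕ} where
    β-δˡ : ∀ (F : Mat m) u y → β F (δ u) y ≈ sumF m (λ v → F u v * y v)
    β-δˡ F u y = trans (sum-cong m (λ t → trans (sum-cong m (λ v → *-assoc _ _ _)) (sum-*ˡ m _ _))) (sum-δˡ m u _)

    β-δʳ : ∀ (F : Mat m) x v → β F x (δ v) ≈ sumF m (λ u → x u * F u v)
    β-δʳ F x v = sum-cong m (λ u → sum-δʳ m v _)

    permutation-congruence : ∀ (π π′ : Fin m → Fin m) → (∀ x → π′ (π x) ≡ x) → (∀ x → π (π′ x) ≡ x) →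
      (F : Mat m) → Congruent F (λ a b → F (π a) (π b))
    permutation-congruence π π′ π′∘π π∘π′ F =
      (λ a → δ (π a)) , (λ a → δ (π′ a)) ,
      (λ a b → trans (sum-δˡ m (π a) (λ u → δ (π′ u) b)) (reflexive (≡.cong (λ x → δ x b) (π′∘π a)))) ,
      (λ a b → trans (sum-δˡ m (π′ a) (λ u → δ (π u) b)) (reflexive (≡.cong (λ x → δ x b) (π∘π′ a)))) ,
      (λ a b → sym (β-δ-δ F (π a) (π b)))

    diagonal : (Fin m → Carrier) → Mat m
    diagonal d a u = d a * δ a u

    diagonal-inverse : ∀ d e → (∀ a → d a * e a ≈ 1#) → diagonal d · diagonal e ≋ I
    diagonal-inverse d e de≈1 a b = begin
      sumF m (λ u → (d a * δ a u) * (e u * δ u b))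
        ≈⟨ sum-cong m (λ u → solve 4 (λ x y z w → (x :* y) :* (z :* w) := y :* (x :* (z :* w))) refl _ _ _ _) ⟩
      sumF m (λ u → δ a u * (d a * (e u * δ u b)))
        ≈⟨ sum-δˡ m a _ ⟩
      d a * (e a * δ a b)
        ≈⟨ trans (sym (*-assoc _ _ _)) (trans (*-congʳ (de≈1 a)) (*-identityˡ _)) ⟩
      δ a b ∎

    conj-diagonal : ∀ d (F : Mat m) a b → conj (diagonal d) F a b ≈ (d a * F a b) * d b
    conj-diagonal d F a b = begin
      sumF m (λ u → sumF m (λ v → ((d a * δ a u) * F u v) * (d b * δ b v)))
        ≈⟨ sum-cong m (λ u → sum-cong m (λ v →
             solve 5 (λ x y z w t → ((x :* y) :* z) :* (w :* t) := t :* (y :* ((x :* z) :* w))) refl _ _ _ _ _)) ⟩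
      sumF m (λ u → sumF m (λ v → δ b v * (δ a u * ((d a * F u v) * d b))))
        ≈⟨ sum-cong m (λ u → sum-δˡ m b _) ⟩
      sumF m (λ u → δ a u * ((d a * F u b) * d b))
        ≈⟨ sum-δˡ m a _ ⟩
      (d a * F a b) * d b ∎

    unipotent-inverse : ∀ (E E′ : Mat m) → (∀ a b → E a b + E′ a b ≈ 0#) →
      (∀ a u b → E a u * E′ u b ≈ 0#) →
      (λ a b → δ a b + E a b) · (λ a b → δ a b + E′ a b) ≋ I
    unipotent-inverse E E′ E+E′≈0 EE′≈0 a b = begin
      sumF m (λ u → (δ a u + E a u) * (δ u b + E′ u b))
        ≈⟨ sum-cong m (λ u → solve 4 (λ p q r s → (p :+ q) :* (r :+ s) := (p :* (r :+ s) :+ r :* q) :+ q :* s)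
                                      refl (δ a u) (E a u) (δ u b) (E′ u b)) ⟩
      sumF m (λ u → (δ a u * (δ u b + E′ u b) + δ u b * E a u) + E a u * E′ u b)
        ≈⟨ trans (sum-+ m _ _) (+-cong (sum-+ m _ _) (sum-zero m (λ u → EE′≈0 a u b))) ⟩
      (sumF m (λ u → δ a u * (δ u b + E′ u b)) + sumF m (λ u → δ u b * E a u)) + 0#
        ≈⟨ trans (+-identityʳ _) (+-cong (sum-δˡ m a _)
             (trans (sum-cong m (λ u → *-congʳ (δ-sym u b))) (sum-δˡ m b _))) ⟩
      (δ a b + E′ a b) + E a b
        ≈⟨ trans (+-assoc _ _ _) (trans (+-congˡ (trans (+-comm _ _) (E+E′≈0 a b))) (+-identityʳ _)) ⟩
      δ a b ∎

  transpose-source : ∀ {n} (i j : Fin n) → transpose i j i ≡ j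
  transpose-source i j rewrite dec-true (i Finₚ.≟ i) ≡.refl = ≡.refl

  transpose-fixed : ∀ {n} {i j k : Fin n} → k ≢ i → k ≢ j → transpose i j k ≡ k
  transpose-fixed {i = i} {j} {k} k≢i k≢j
    rewrite dec-false (k Finₚ.≟ i) k≢i | dec-false (k Finₚ.≟ j) k≢j = ≡.refl

  transposition-congruence : ∀ {m} (i j : Fin m) (F : Mat m) →
    Congruent F (λ a b → F (transpose i j a) (transpose i j b))
  transposition-congruence i j =
    permutation-congruence (transpose i j) (transpose j i) (λ _ → transpose-inverse j i) (λ _ → transpose-inverse i j)

  pivot-to-corner : ∀ {m} (F : Mat (suc (suc m))) → Skew F → (i j : Fin (suc (suc m))) → ¬ (F i j ≈ 0#) →
    ∃ λ F′ → Congruent F F′ × Skew F′ × F′ zero (suc zero) ≈ 1#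
  pivot-to-corner {m} F skew i j Fij≉0 =
    F₃ , C , Congruent-skew C skew , F₃-corner
    where
      i≢j : i ≢ j
      i≢j ≡.refl = Fij≉0 (proj₂ skew i)
      -- move i to position 0, and then the image j′ of j to position 1
      π₁ = transpose zero i
      j′ = transpose i zero j
      j′≢0 : j′ ≢ zero
      j′≢0 j′≡0 = i≢j (≡.trans (≡.sym (transpose-source zero i))
                        (≡.trans (≡.cong π₁ (≡.sym j′≡0)) (transpose-inverse zero i)))
      π₂ = transpose (suc zero) j′
      F₂ : Mat (suc (suc m))
      F₂ a b = F (π₁ (π₂ a)) (π₁ (π₂ b))
      F₂-corner : F₂ zero (suc zero) ≡ F i j
      F₂-corner = ≡.cong₂ F
        (≡.trans (≡.cong π₁ (transpose-fixed {i = suc zero} {j′} {zero} (λ ()) (j′≢0 ∘ ≡.sym))) (transpose-source zero i))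
        (≡.trans (≡.cong π₁ (transpose-source (suc zero) j′)) (transpose-inverse zero i))
      -- scale the first row and column by the inverse z of F i j
      z = proj₁ (inverse (F i j) Fij≉0)
      d : Fin (suc (suc m)) → Carrier
      d zero    = z
      d (suc _) = 1#
      e : Fin (suc (suc m)) → Carrier
      e zero    = F i j
      e (suc _) = 1#
      de≈1 : ∀ a → d a * e a ≈ 1#
      de≈1 zero    = trans (*-comm _ _) (proj₂ (inverse (F i j) Fij≉0))
      de≈1 (suc _) = *-identityˡ 1#
      ed≈1 : ∀ a → e a * d a ≈ 1#
      ed≈1 a = trans (*-comm _ _) (de≈1 a)
      F₃ = conj (diagonal d) F₂
      C : Congruent F F₃
      C = Congruent-trans {G = F} {H = λ a b → F (π₁ a) (π₁ b)} {K = F₃} (transposition-congruence zero i F)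
            (Congruent-trans {G = λ a b → F (π₁ a) (π₁ b)} {H = F₂} {K = F₃} (transposition-congruence (suc zero) j′ (λ a b → F (π₁ a) (π₁ b)))
              (diagonal d , diagonal e , diagonal-inverse d e de≈1 , diagonal-inverse e d ed≈1 , ≋-refl))
      F₃-corner : F₃ zero (suc zero) ≈ 1#
      F₃-corner = trans (conj-diagonal d F₂ zero (suc zero))
        (trans (*-identityʳ _) (trans (*-congˡ (reflexive F₂-corner)) (de≈1 zero)))

  -- with F 0 1 = 1, the congruence by P = I + E, where row 2+l of E is
  -- F 1 (2+l) e₀ - F 0 (2+l) e₁, clears the first two rows and columns
  module Elimination {m : ℕ} (F : Mat (suc (suc m))) (skew : Skew F)
                     (corner : F zero (suc zero) ≈ 1#) where
    E : Mat (suc (suc m))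
    E (suc (suc l)) zero       = F (suc zero) (suc (suc l))
    E (suc (suc l)) (suc zero) = - F zero (suc (suc l))
    E _             _          = 0#

    -- E a u · E u b = 0 (also after negating either factor): the columns ≥ 2
    -- and the rows < 2 of E vanish
    E-product : ∀ (x y : Carrier → Carrier) → x 0# ≈ 0# → y 0# ≈ 0# →
      ∀ a u b → x (E a u) * y (E u b) ≈ 0#
    E-product x y x0 y0 a             zero          b = trans (*-congˡ y0) (zeroʳ _)
    E-product x y x0 y0 a             (suc zero)    b = trans (*-congˡ y0) (zeroʳ _)
    E-product x y x0 y0 zero          (suc (suc w)) b = trans (*-congʳ x0) (zeroˡ _)
    E-product x y x0 y0 (suc zero)    (suc (suc w)) b = trans (*-congʳ x0) (zeroˡ _)
    E-product x y x0 y0 (suc (suc l)) (suc (suc w)) b = trans (*-congʳ x0) (zeroˡ _)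

    P : Mat (suc (suc m))
    P a b = δ a b + E a b

    P-invertible : Σ (Mat (suc (suc m))) λ Q → (P · Q ≋ I) × (Q · P ≋ I)
    P-invertible = (λ a b → δ a b + - E a b) ,
      unipotent-inverse E (λ a b → - E a b) (λ a b → -‿inverseʳ _) (E-product (λ x → x) -_ refl -0#≈0#) ,
      unipotent-inverse (λ a b → - E a b) E (λ a b → -‿inverseˡ _) (E-product -_ (λ x → x) -0#≈0# refl)

    F′ : Mat (suc (suc m))
    F′ = conj P F

    F′-skew : Skew F′
    F′-skew = conj-skew P skew

    expansion : ∀ u l → β F (δ u) (P (suc (suc l))) ≈
      F u zero * F (suc zero) (suc (suc l)) + (F u (suc zero) * - F zero (suc (suc l)) + F u (suc (suc l)))
    expansion u l = trans (β-δˡ F u (P (suc (suc l))))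
      (+-cong (*-congˡ (+-identityˡ _)) (+-cong (*-congˡ (+-identityˡ _))
        (trans (sum-cong m (λ w → *-congˡ (+-identityʳ _))) (sum-δʳ m l _))))

    F-anti-corner : F (suc zero) zero ≈ - 1#
    F-anti-corner = trans (proj₁ skew zero (suc zero)) (-‿cong corner)

    -- rows 0 and 1 of P are the basis vectors e₀ and e₁ (as rows 0, 1 of E vanish),
    -- so F′ keeps F 0 1 = 1 while the rest of its first two rows vanish
    top-row : ∀ u → (∀ t → E u t ≈ 0#) → ∀ y → β F (P u) y ≈ β F (δ u) y
    top-row u Eu≈0 y = β-cong {F = F} {x = P u} {δ u} {y} {y} ≋-refl
                         (λ t → trans (+-congˡ (Eu≈0 t)) (+-identityʳ _)) (λ _ → refl)

    F′-corner : F′ zero (suc zero) ≈ 1#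
    F′-corner = trans (top-row zero (λ _ → refl) (P (suc zero)))
      (trans (β-cong {F = F} {x = δ zero} {δ zero} {P (suc zero)} {δ (suc zero)} ≋-refl (λ _ → refl) (λ _ → +-identityʳ _)) (trans (β-δ-δ F zero (suc zero)) corner))

    F′-row₀ : ∀ l → F′ zero (suc (suc l)) ≈ 0#
    F′-row₀ l = begin
      F′ zero (suc (suc l))
        ≈⟨ trans (top-row zero (λ _ → refl) (P (suc (suc l)))) (expansion zero l) ⟩
      F zero zero * y + (F zero (suc zero) * - x + x)
        ≈⟨ +-cong (trans (*-congʳ (proj₂ skew zero)) (zeroˡ _)) (+-congʳ (trans (*-congʳ corner) (*-identityˡ _))) ⟩
      0# + (- x + x)
        ≈⟨ trans (+-identityˡ _) (-‿inverseˡ x) ⟩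
      0# ∎
      where x = F zero (suc (suc l)) ; y = F (suc zero) (suc (suc l))

    F′-row₁ : ∀ l → F′ (suc zero) (suc (suc l)) ≈ 0#
    F′-row₁ l = begin
      F′ (suc zero) (suc (suc l))
        ≈⟨ trans (top-row (suc zero) (λ _ → refl) (P (suc (suc l)))) (expansion (suc zero) l) ⟩
      F (suc zero) zero * y + (F (suc zero) (suc zero) * - x + y)
        ≈⟨ +-cong (trans (*-congʳ F-anti-corner) (-1*x≈-x y)) (+-congʳ (trans (*-congʳ (proj₂ skew (suc zero))) (zeroˡ _))) ⟩
      - y + (0# + y)
        ≈⟨ trans (+-congˡ (+-identityˡ y)) (-‿inverseˡ y) ⟩
      0# ∎
      where x = F zero (suc (suc l)) ; y = F (suc zero) (suc (suc l))

    inner : Mat m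
    inner i j = F′ (suc (suc i)) (suc (suc j))

    inner-skew : Skew inner
    inner-skew = (λ i j → proj₁ F′-skew (suc (suc i)) (suc (suc j))) , (λ i → proj₂ F′-skew (suc (suc i)))

    F′-block : F′ ≋ blockJ inner
    F′-block zero          zero          = proj₂ F′-skew zero
    F′-block zero          (suc zero)    = F′-corner
    F′-block zero          (suc (suc j)) = F′-row₀ j
    F′-block (suc zero)    zero          = trans (proj₁ F′-skew zero (suc zero)) (-‿cong F′-corner)
    F′-block (suc zero)    (suc zero)    = proj₂ F′-skew (suc zero)
    F′-block (suc zero)    (suc (suc j)) = F′-row₁ j
    F′-block (suc (suc i)) zero          = trans (proj₁ F′-skew zero (suc (suc i))) (trans (-‿cong (F′-row₀ i)) -0#≈0#)
    F′-block (suc (suc i)) (suc zero)    = trans (proj₁ F′-skew (suc zero) (suc (suc i))) (trans (-‿cong (F′-row₁ i)) -0#≈0#)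
    F′-block (suc (suc i)) (suc (suc j)) = refl

    eliminate : Congruent F (blockJ inner)
    eliminate = let (Q , PQ , QP) = P-invertible in P , Q , PQ , QP , ≋-sym F′-block

  -- I₂ ⊕ P, which turns a congruence X ∼ Y into J ⊕ X ∼ J ⊕ Y
  blockI : ∀ {m} → Mat m → Mat (suc (suc m))
  blockI P zero          = δ zero
  blockI P (suc zero)    = δ (suc zero)
  blockI P (suc (suc a)) zero          = 0#
  blockI P (suc (suc a)) (suc zero)    = 0#
  blockI P (suc (suc a)) (suc (suc b)) = P a b

  module _ {m : ℕ} where
    blockI-cong : ∀ {P P′ : Mat m} → P ≋ P′ → blockI P ≋ blockI P′
    blockI-cong P≋P′ zero          b             = refl
    blockI-cong P≋P′ (suc zero)    b             = refl
    blockI-cong P≋P′ (suc (suc a)) zero          = refl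
    blockI-cong P≋P′ (suc (suc a)) (suc zero)    = refl
    blockI-cong P≋P′ (suc (suc a)) (suc (suc b)) = P≋P′ a b

    blockI-I : blockI {m} I ≋ I
    blockI-I zero          b             = refl
    blockI-I (suc zero)    b             = refl
    blockI-I (suc (suc a)) zero          = refl
    blockI-I (suc (suc a)) (suc zero)    = refl
    blockI-I (suc (suc a)) (suc (suc b)) = refl

    drop-two : ∀ x y (g : Fin m → Carrier) → 0# * x + (0# * y + sumF m g) ≈ sumF m g
    drop-two x y g = trans (+-cong (zeroˡ x) (+-congʳ (zeroˡ y))) (trans (+-identityˡ _) (+-identityˡ _))

    blockI-· : ∀ (P Q : Mat m) → blockI P · blockI Q ≋ blockI (P · Q)
    blockI-· P Q zero          b             = sum-δˡ _ zero (λ u → blockI Q u b)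
    blockI-· P Q (suc zero)    b             = sum-δˡ _ (suc zero) (λ u → blockI Q u b)
    blockI-· P Q (suc (suc a)) zero          = trans (drop-two _ _ _) (sum-zero m (λ w → zeroʳ _))
    blockI-· P Q (suc (suc a)) (suc zero)    = trans (drop-two _ _ _) (sum-zero m (λ w → zeroʳ _))
    blockI-· P Q (suc (suc a)) (suc (suc b)) = drop-two _ _ _

    conj-blockI : ∀ (P X : Mat m) → conj (blockI P) (blockJ X) ≋ blockJ (conj P X)
    conj-blockI P X zero          zero          = β-δ-δ (blockJ X) zero zero
    conj-blockI P X zero          (suc zero)    = β-δ-δ (blockJ X) zero (suc zero)
    conj-blockI P X (suc zero)    zero          = β-δ-δ (blockJ X) (suc zero) zero
    conj-blockI P X (suc zero)    (suc zero)    = β-δ-δ (blockJ X) (suc zero) (suc zero)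
    conj-blockI P X zero          (suc (suc b)) = trans (β-δˡ (blockJ X) zero (blockI P (suc (suc b))))
      (trans (+-cong (zeroˡ _) (+-cong (zeroʳ _) (sum-zero m (λ w → zeroˡ _)))) (trans (+-identityˡ _) (+-identityˡ 0#)))
    conj-blockI P X (suc zero)    (suc (suc b)) = trans (β-δˡ (blockJ X) (suc zero) (blockI P (suc (suc b))))
      (trans (+-cong (zeroʳ _) (+-cong (zeroˡ _) (sum-zero m (λ w → zeroˡ _)))) (trans (+-identityˡ _) (+-identityˡ 0#)))
    conj-blockI P X (suc (suc a)) zero          = trans (β-δʳ (blockJ X) (blockI P (suc (suc a))) zero)
      (trans (drop-two _ _ _) (sum-zero m (λ w → zeroʳ _)))
    conj-blockI P X (suc (suc a)) (suc zero)    = trans (β-δʳ (blockJ X) (blockI P (suc (suc a))) (suc zero))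
      (trans (drop-two _ _ _) (sum-zero m (λ w → zeroʳ _)))
    conj-blockI P X (suc (suc a)) (suc (suc b)) =
      trans (+-cong (vanishing (blockJ X zero)) (+-cong (vanishing (blockJ X (suc zero))) (sum-cong m drop-two′)))
            (trans (+-identityˡ _) (+-identityˡ _))
      where
        y = blockI P (suc (suc b))
        vanishing : ∀ (r : Fin (suc (suc m)) → Carrier) → sumF (suc (suc m)) (λ v → (0# * r v) * y v) ≈ 0#
        vanishing r = sum-zero _ (λ v → trans (*-congʳ (zeroˡ (r v))) (zeroˡ (y v)))
        drop-two′ : ∀ w → sumF (suc (suc m)) (λ v → (P a w * blockJ X (suc (suc w)) v) * y v)
                           ≈ sumF m (λ v → (P a w * X w v) * P b v)
        drop-two′ w = trans (+-cong (zeroʳ _) (+-cong (zeroʳ _) refl)) (trans (+-identityˡ _) (+-identityˡ _))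

  Congruent-blockJ : ∀ {m} {X Y : Mat m} → Congruent X Y → Congruent (blockJ X) (blockJ Y)
  Congruent-blockJ {X = X} (P , Q , PQ , QP , Y≋) =
    blockI P , blockI Q ,
    ≋-trans (blockI-· P Q) (≋-trans (blockI-cong PQ) blockI-I) ,
    ≋-trans (blockI-· Q P) (≋-trans (blockI-cong QP) blockI-I) ,
    ≋-trans (blockJ-cong Y≋) (≋-sym (conj-blockI P X))

  classify : ∀ m (F : Mat m) → Skew F → ∃ λ k → k ℕ.* 2 ℕ.≤ m × Congruent F (Nf k m)
  classify zero          F skew = 0 , z≤n , Congruent-reflexive {G = F} {H = zeroMat} (λ ())
  classify (suc zero)    F skew = 0 , z≤n , Congruent-reflexive {G = F} {H = zeroMat} (λ { zero zero → proj₂ skew zero })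
  classify (suc (suc m)) F skew with Finₚ.all? (λ i → Finₚ.all? (λ j → F i j ≟ 0#))
  ... | yes F≋0 = 0 , z≤n , Congruent-reflexive {G = F} {H = zeroMat} F≋0
  ... | no F≉0 with Finₚ.¬∀⟶∃¬ _ _ (λ i → Finₚ.all? (λ j → F i j ≟ 0#)) F≉0
  ... | i , row≉0 with Finₚ.¬∀⟶∃¬ _ _ (λ j → F i j ≟ 0#) row≉0
  ... | j , Fij≉0 =
    let (F′ , F∼F′ , F′-skew , corner) = pivot-to-corner F skew i j Fij≉0
        open Elimination F′ F′-skew corner using (inner; inner-skew; eliminate)
        (k , 2k≤m , inner∼Nf) = classify m inner inner-skew
    in suc k , s≤s (s≤s 2k≤m) ,
       Congruent-trans {G = F} {F′} F∼F′ (Congruent-trans {G = F′} {blockJ inner} eliminate (Congruent-blockJ inner∼Nf))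

module Counting {c ℓ} (𝔽 : FiniteField c ℓ) where
  open FiniteField 𝔽 hiding (zero)
  open FF 𝔽
  open Matrices 𝔽

  private
    module Vectors = Enumeration _≈_ elements complete
    module AllMatrices (m : ℕ) = Enumeration Vectors._≅_ (Vectors.functions m) (Vectors.functions-cover m)

  allMats-cover : ∀ {m} (A : Mat m) → Any (A ≋_) (AllMatrices.functions m m)
  allMats-cover {m} A = AllMatrices.functions-cover m m A

  _≋?_ : ∀ {m} (A B : Mat m) → Dec (A ≋ B)
  A ≋? B = Finₚ.all? (λ i → Finₚ.all? (λ j → A i j ≟ B i j))

  card-exists : ∀ {m} (P : Mat m → Set (c ⊔ ℓ)) → (∀ A → Dec (P A)) →
    (∀ {A B} → A ≋ B → P A → P B) → ∃ λ n → Card P n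
  card-exists {m} P P? resp =
    let open Representatives P P? _≋_ _≋?_ ≋-trans resp
        open Selection (select (AllMatrices.functions m m))
    in length reps , reps , ≡.refl , all-P , distinct , (λ A PA → covers A PA (allMats-cover A))

  nonzero-* : ∀ {x y} → ¬ (x ≈ 0#) → ¬ (y ≈ 0#) → ¬ (x * y ≈ 0#)
  nonzero-* {x} {y} x≉0 y≉0 xy≈0 with inverse x x≉0
  ... | x⁻¹ , xx⁻¹≈1 = y≉0 (begin
    y              ≈⟨ sym (*-identityˡ y) ⟩
    1# * y         ≈⟨ *-congʳ (sym (trans (*-comm _ _) xx⁻¹≈1)) ⟩
    (x⁻¹ * x) * y  ≈⟨ *-assoc _ _ _ ⟩
    x⁻¹ * (x * y)  ≈⟨ *-congˡ xy≈0 ⟩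
    x⁻¹ * 0#       ≈⟨ zeroʳ _ ⟩
    0# ∎)
    where open import Relation.Binary.Reasoning.Setoid setoid

  cancel-nonzero : ∀ {x y} → ¬ (x ≈ 0#) → x * y ≈ 0# → y ≈ 0#
  cancel-nonzero {y = y} x≉0 xy≈0 with y ≟ 0#
  ... | yes y≈0 = y≈0
  ... | no y≉0  = ⊥-elim (nonzero-* x≉0 y≉0 xy≈0)

  module _ {m : ℕ} where
    Proportional-reflexive : ∀ {A B : Mat m} → A ≋ B → Proportional A B
    Proportional-reflexive A≋B = 1# , (λ 1≈0 → 0≉1 (sym 1≈0)) , (λ i j → trans (A≋B i j) (sym (*-identityˡ _)))

    Proportional-trans : ∀ {A B C : Mat m} → Proportional A B → Proportional B C → Proportional A C
    Proportional-trans (λ₁ , λ₁≉0 , A≈) (λ₂ , λ₂≉0 , B≈) =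
      λ₁ * λ₂ , nonzero-* λ₁≉0 λ₂≉0 , (λ i j → trans (A≈ i j) (trans (*-congˡ (B≈ i j)) (sym (*-assoc _ _ _))))

    Proportional-sym : ∀ {A B : Mat m} → Proportional A B → Proportional B A
    Proportional-sym (λ′ , λ′≉0 , A≈) with inverse λ′ λ′≉0
    ... | μ , λ′μ≈1 = μ , (λ μ≈0 → 0≉1 (trans (sym (zeroʳ λ′)) (trans (*-congˡ (sym μ≈0)) λ′μ≈1))) ,
      (λ i j → sym (trans (*-congˡ (A≈ i j))
        (trans (sym (*-assoc _ _ _)) (trans (*-congʳ (trans (*-comm _ _) λ′μ≈1)) (*-identityˡ _)))))

    Proportional? : (A B : Mat m) → Dec (Proportional A B)
    Proportional? A B with Any.any? (λ λ′ → ¬? (λ′ ≟ 0#) ×-dec (A ≋? (λ i j → λ′ * B i j))) elements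
    ... | yes some = yes (Any.satisfied some)
    ... | no none = no λ (λ′ , λ′≉0 , A≈) → none (Any.map
      (λ λ′≈μ → (λ μ≈0 → λ′≉0 (trans λ′≈μ μ≈0)) , (λ i j → trans (A≈ i j) (*-congʳ λ′≈μ))) (complete λ′))

  projcard-exists : ∀ {m} (P : Mat m → Set (c ⊔ ℓ)) → (∀ A → Dec (P A)) →
    (∀ {A B} → Proportional A B → P A → P B) → ∃ λ n → ProjCard P n
  projcard-exists {m} P P? resp =
    let open Representatives P P? Proportional Proportional? Proportional-trans resp
        open Selection (select (AllMatrices.functions m m))
    in length reps , reps , ≡.refl , all-P , distinct ,
       (λ A PA → covers A PA (Any.map Proportional-reflexive (allMats-cover A)))

  module Transport {m : ℕ} (P₁ P₂ : Mat m → Set (c ⊔ ℓ)) (φ ψ : Mat m → Mat m)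
      (φ-cong : ∀ {A B} → A ≋ B → φ A ≋ φ B) (ψ-cong : ∀ {A B} → A ≋ B → ψ A ≋ ψ B)
      (ψφ : ∀ A → ψ (φ A) ≋ A) (φψ : ∀ B → φ (ψ B) ≋ B)
      (P₁⇒P₂ : ∀ A → P₁ A → P₂ (φ A)) (P₂⇒P₁ : ∀ B → P₂ B → P₁ (ψ B)) where

    card : ∀ {n} → Card P₁ n → Card P₂ n
    card (xs , len , all-P₁ , distinct , covers) =
      map φ xs , ≡.trans (length-map φ xs) len ,
      Allₚ.map⁺ (All.map (P₁⇒P₂ _) all-P₁) ,
      AllPairsₚ.map⁺ (AllPairs.map
        (λ A≉B φA≋φB → A≉B (≋-trans (≋-sym (ψφ _)) (≋-trans (ψ-cong φA≋φB) (ψφ _)))) distinct) ,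
      (λ B P₂B → Anyₚ.map⁺ (Any.map (λ ψB≋A → ≋-trans (≋-sym (φψ B)) (φ-cong ψB≋A)) (covers (ψ B) (P₂⇒P₁ B P₂B))))

    module _ (φ-homogeneous : ∀ A x → φ (λ i j → x * A i j) ≋ (λ i j → x * φ A i j))
             (ψ-homogeneous : ∀ A x → ψ (λ i j → x * A i j) ≋ (λ i j → x * ψ A i j)) where

      private
        Proportional-resp : ∀ {A A′ B B′ : Mat m} → A ≋ A′ → B ≋ B′ → Proportional A′ B′ → Proportional A B
        Proportional-resp A≋ B≋ (λ′ , λ′≉0 , A′≈) =
          λ′ , λ′≉0 , (λ i j → trans (A≋ i j) (trans (A′≈ i j) (*-congˡ (sym (B≋ i j)))))

        map-Proportional : ∀ (χ : Mat m → Mat m) → (∀ {A B} → A ≋ B → χ A ≋ χ B) →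
          (∀ A x → χ (λ i j → x * A i j) ≋ (λ i j → x * χ A i j)) →
          ∀ {A B} → Proportional A B → Proportional (χ A) (χ B)
        map-Proportional χ χ-cong χ-hom {B = B} (λ′ , λ′≉0 , A≈) = λ′ , λ′≉0 , ≋-trans (χ-cong A≈) (χ-hom B λ′)

      projcard : ∀ {n} → ProjCard P₁ n → ProjCard P₂ n
      projcard (xs , len , all-P₁ , distinct , covers) =
        map φ xs , ≡.trans (length-map φ xs) len ,
        Allₚ.map⁺ (All.map (P₁⇒P₂ _) all-P₁) ,
        AllPairsₚ.map⁺ (AllPairs.map
          (λ A≁B φA∼φB → A≁B (Proportional-resp (≋-sym (ψφ _)) (≋-sym (ψφ _))
                                (map-Proportional ψ ψ-cong ψ-homogeneous φA∼φB))) distinct) ,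
        (λ B P₂B → Anyₚ.map⁺ (Any.map (λ ψB∼A → Proportional-resp (≋-sym (φψ B)) ≋-refl
                                                   (map-Proportional φ φ-cong φ-homogeneous ψB∼A))
                                        (covers (ψ B) (P₂⇒P₁ B P₂B))))

module Supports {c ℓ} (𝔽 : FiniteField c ℓ) {m : ℕ} (s : ℕ) where
  open FiniteField 𝔽 hiding (zero)
  open FF 𝔽
  open Sums 𝔽
  open Matrices 𝔽
  open Rank 𝔽
  open NormalForm 𝔽
  open Reduction 𝔽
  open Counting 𝔽
  open import Algebra.Properties.Ring ring using (-‿distribʳ-*)
  open import Algebra.Solver.Ring.NaturalCoefficients.Default commutativeSemiring
    using (solve; _:*_; _:=_)

  HatSupport : Mat m → Mat m → Set (c ⊔ ℓ)
  HatSupport G A = Skew A × RankLe A s × ¬ ((- tr G A) ≈ 0#)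

  ProjSupport : Mat m → Mat m → Set (c ⊔ ℓ)
  ProjSupport G B = Skew B × ¬ (B ≋ zeroMat) × RankLe B s × ¬ (tr G B ≈ 0#)

  Skew? : (A : Mat m) → Dec (Skew A)
  Skew? A = Finₚ.all? (λ i → Finₚ.all? (λ j → A j i ≟ (- A i j))) ×-dec Finₚ.all? (λ i → A i i ≟ 0#)

  HatSupport? : ∀ G A → Dec (HatSupport G A)
  HatSupport? G A = Skew? A ×-dec RankLe? A s ×-dec ¬? ((- tr G A) ≟ 0#)

  ProjSupport? : ∀ G A → Dec (ProjSupport G A)
  ProjSupport? G A = Skew? A ×-dec ¬? (A ≋? zeroMat) ×-dec RankLe? A s ×-dec ¬? (tr G A ≟ 0#)

  HatSupport-resp : ∀ G {A B} → A ≋ B → HatSupport G A → HatSupport G B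
  HatSupport-resp G A≋B (skew , rank , nonzero) =
    Skew-cong A≋B skew , RankLe-cong A≋B rank , λ tr≈0 → nonzero (trans (-‿cong (tr-cong ≋-refl A≋B)) tr≈0)

  tr-scale : ∀ x (G A : Mat m) → tr G (λ i j → x * A i j) ≈ x * tr G A
  tr-scale x G A = trans (sum-cong m (λ i → trans (sum-cong m (λ j →
      solve 3 (λ g x a → g :* (x :* a) := x :* (g :* a)) refl (G i j) x (A j i))) (sum-*ˡ m x _)))
    (sum-*ˡ m x _)

  Skew-scale : ∀ x {A : Mat m} → Skew A → Skew (λ i j → x * A i j)
  Skew-scale x (anti , diag) = (λ i j → trans (*-congˡ (anti i j)) (sym (-‿distribʳ-* _ _))) ,
                               (λ i → trans (*-congˡ (diag i)) (zeroʳ x))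

  ProjSupport-resp : ∀ G {A B} → Proportional A B → ProjSupport G A → ProjSupport G B
  ProjSupport-resp G {A} A∼B (skew , A≉0 , rank , nonzero) with Proportional-sym A∼B
  ... | λ′ , λ′≉0 , B≈λ′A =
    Skew-cong (≋-sym B≈λ′A) (Skew-scale λ′ skew) ,
    (λ B≋0 → A≉0 (λ i j → cancel-nonzero λ′≉0 (trans (sym (B≈λ′A i j)) (B≋0 i j)))) ,
    RankLe-cong (≋-sym B≈λ′A) (RankLe-scale λ′ A s rank) ,
    (λ trB≈0 → nonzero (cancel-nonzero λ′≉0
      (trans (sym (tr-scale λ′ G A)) (trans (tr-cong ≋-refl (≋-sym B≈λ′A)) trB≈0))))

  -- For H = P G Pᵀ (Q = P⁻¹), A ↦ Qᵀ A Q is a bijection between the supports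
  -- of G and of H, since tr(G A) = tr(H (Qᵀ A Q)).
  module Congruence-invariance {G H : Mat m} (C : Congruent G H) where
    private
      P = proj₁ C
      Q = proj₁ (proj₂ C)
      φ ψ : Mat m → Mat m
      φ = conj (Q ᵀ)
      ψ = conj (P ᵀ)

      conj-inverse : ∀ (X Y : Mat m) → X · Y ≋ I → ∀ A → conj (Y ᵀ) (conj (X ᵀ) A) ≋ A
      conj-inverse X Y XY A =
        ≋-trans (conj-· (Y ᵀ) (X ᵀ) A)
          (≋-trans (conj-cong (≋-trans (·-ᵀ X Y) (λ a b → trans (XY b a) (δ-sym b a))) ≋-refl) (conj-I A))

      ψφ : ∀ A → ψ (φ A) ≋ A
      ψφ = conj-inverse Q P (proj₁ (proj₂ (proj₂ (proj₂ C))))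
      φψ : ∀ A → φ (ψ A) ≋ A
      φψ = conj-inverse P Q (proj₁ (proj₂ (proj₂ C)))

      tr-φ : ∀ A → tr G A ≈ tr H (φ A)
      tr-φ A = trans (tr-cong (Congruent-inverse C) ≋-refl) (tr-conj Q H A)
      tr-ψ : ∀ A → tr H A ≈ tr G (ψ A)
      tr-ψ A = trans (tr-cong (proj₂ (proj₂ (proj₂ (proj₂ C)))) ≋-refl) (tr-conj P G A)

      nonzero : ∀ (χ χ′ : Mat m) A → (∀ A → conj χ′ (conj χ A) ≋ A) → ¬ (A ≋ zeroMat) → ¬ (conj χ A ≋ zeroMat)
      nonzero χ χ′ A undo A≉0 χA≋0 =
        A≉0 (≋-trans (≋-sym (undo A)) (≋-trans (conj-cong ≋-refl χA≋0) (conj-zero χ′)))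

    hat : ∀ {n} → Card (HatSupport G) n → Card (HatSupport H) n
    hat = Transport.card (HatSupport G) (HatSupport H) φ ψ (conj-cong ≋-refl) (conj-cong ≋-refl) ψφ φψ
      (λ A (skew , rank , tr≉0) → conj-skew _ skew , RankLe-conj _ A s rank , λ tr≈0 → tr≉0 (trans (-‿cong (tr-φ A)) tr≈0))
      (λ B (skew , rank , tr≉0) → conj-skew _ skew , RankLe-conj _ B s rank , λ tr≈0 → tr≉0 (trans (-‿cong (tr-ψ B)) tr≈0))

    proj : ∀ {n} → ProjCard (ProjSupport G) n → ProjCard (ProjSupport H) n
    proj = Transport.projcard (ProjSupport G) (ProjSupport H) φ ψ (conj-cong ≋-refl) (conj-cong ≋-refl) ψφ φψ
      (λ A (skew , A≉0 , rank , tr≉0) → conj-skew _ skew , nonzero (Q ᵀ) (P ᵀ) A ψφ A≉0 ,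
                                         RankLe-conj _ A s rank , λ tr≈0 → tr≉0 (trans (tr-φ A) tr≈0))
      (λ B (skew , B≉0 , rank , tr≉0) → conj-skew _ skew , nonzero (P ᵀ) (Q ᵀ) B φψ B≉0 ,
                                         RankLe-conj _ B s rank , λ tr≈0 → tr≉0 (trans (tr-ψ B) tr≈0))
      (λ A x → conj-scale (Q ᵀ) A x) (λ A x → conj-scale (P ᵀ) A x)

module Weights {c ℓ} (𝔽 : FiniteField c ℓ) (m s : ℕ) where
  open FiniteField 𝔽 hiding (zero)
  open FF 𝔽
  open Matrices 𝔽
  open NormalForm 𝔽
  open Reduction 𝔽
  open Counting 𝔽
  open Supports 𝔽 {m} s

  hatWeight : ℕ → ℕ
  hatWeight k = proj₁ (card-exists (HatSupport (Nf k m)) (HatSupport? _) (HatSupport-resp _))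

  projWeight : ℕ → ℕ
  projWeight k = proj₁ (projcard-exists (ProjSupport (Nf k m)) (ProjSupport? _) (ProjSupport-resp _))

  hat-weight-by-rank : ∀ r (G : Mat m) → Skew G → HasRank G r → Card (HatSupport G) (hatWeight (r ℕ./ 2))
  hat-weight-by-rank r G skew rankG =
    let (k , 2k≤m , G∼Nf) = classify m G skew
        k≡r/2 : k ≡ r ℕ./ 2
        k≡r/2 = ≡.trans (≡.sym (m*n/n≡m k 2)) (≡.cong (ℕ._/ 2) (≡.sym (rank-of-normal-form G r k rankG G∼Nf 2k≤m)))
    in ≡.subst (λ k → Card (HatSupport G) (hatWeight k)) k≡r/2
         (Congruence-invariance.hat (Congruent-sym G∼Nf)
           (proj₂ (card-exists (HatSupport (Nf k m)) (HatSupport? _) (HatSupport-resp _))))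

  proj-weight-by-rank : ∀ (G : Mat m) k → Congruent G (Nf k m) → ProjCard (ProjSupport G) (projWeight k)
  proj-weight-by-rank G k G∼Nf = Congruence-invariance.proj (Congruent-sym G∼Nf)
    (proj₂ (projcard-exists (ProjSupport (Nf k m)) (ProjSupport? _) (ProjSupport-resp _)))

module ProjectiveCode {c ℓ} (𝔽 : FiniteField c ℓ) (odd : OddOrder 𝔽) (m s : ℕ) where
  open FiniteField 𝔽 hiding (zero)
  open FF 𝔽
  open Sums 𝔽
  open Matrices 𝔽
  open NormalForm 𝔽
  open Reduction 𝔽
  open Counting 𝔽
  open Supports 𝔽 {m} s
  open Weights 𝔽 m s
  open import Relation.Binary.Reasoning.Setoid setoid
  open import Algebra.Properties.Ring ring using (-‿+-comm; -‿involutive; -‿distribˡ-*; -‿distribʳ-*)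
  open import Algebra.Solver.Ring.NaturalCoefficients.Default commutativeSemiring
    using (solve; _:+_; _:*_; _:=_; con)

  -- x + x ≈ 0 forces x ≈ 0 as 2 is invertible
  double-zero : ∀ x → x + x ≈ 0# → x ≈ 0#
  double-zero x x+x≈0 with inverse (1# + 1#) odd
  ... | h , 2h≈1 = begin
    x                      ≈⟨ sym (*-identityˡ x) ⟩
    1# * x                 ≈⟨ *-congʳ (sym 2h≈1) ⟩
    ((1# + 1#) * h) * x    ≈⟨ solve 2 (λ x h → (((con 1 :+ con 1) :* h) :* x) := (h :* (x :+ x))) refl x h ⟩
    h * (x + x)            ≈⟨ *-congˡ x+x≈0 ⟩
    h * 0#                 ≈⟨ zeroʳ h ⟩
    0# ∎

  lower : Mat m → Mat m
  lower f i j = if does (j <? i) then f j i else 0#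

  formMatrix : Mat m → Mat m
  formMatrix f i j = lower f i j + - lower f j i

  formMatrix-skew : ∀ f → Skew (formMatrix f)
  formMatrix-skew f =
    (λ i j → trans (+-comm _ _) (trans (+-congˡ (sym (-‿involutive _))) (-‿+-comm _ _))) ,
    (λ i → -‿inverseʳ _)

  if-* : ∀ b x y → (if b then x else 0#) * y ≈ (if b then x * y else 0#)
  if-* true  x y = refl
  if-* false x y = zeroˡ y

  -- tr(F_f B) = 2 f(B) for skew B: each pair i < j is counted twice
  tr-formMatrix : ∀ f (B : Mat m) → Skew B → tr (formMatrix f) B ≈ evalForm f B + evalForm f B
  tr-formMatrix f B (anti , _) = begin
    sumF m (λ i → sumF m (λ j → (lower f i j + - lower f j i) * B j i))
      ≈⟨ sum-cong m (λ i → trans (sum-cong m (λ j → distribʳ _ _ _)) (sum-+ m _ _)) ⟩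
    sumF m (λ i → sumF m (λ j → lower f i j * B j i) + sumF m (λ j → - lower f j i * B j i))
      ≈⟨ sum-+ m _ _ ⟩
    sumF m (λ i → sumF m (λ j → lower f i j * B j i)) + sumF m (λ i → sumF m (λ j → - lower f j i * B j i))
      ≈⟨ +-cong lower-part upper-part ⟩
    evalForm f B + evalForm f B ∎
    where
      lower-part : sumF m (λ i → sumF m (λ j → lower f i j * B j i)) ≈ evalForm f B
      lower-part = trans (sum-swap m m _) (sum-cong m (λ j → sum-cong m (λ i → if-* (does (j <? i)) (f j i) (B j i))))
      upper-part : sumF m (λ i → sumF m (λ j → - lower f j i * B j i)) ≈ evalForm f B
      upper-part = sum-cong m (λ i → sum-cong m (λ j → begin
        - lower f j i * B j i   ≈⟨ *-congˡ (anti i j) ⟩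
        - lower f j i * - B i j ≈⟨ trans (sym (-‿distribˡ-* _ _)) (trans (-‿cong (sym (-‿distribʳ-* _ _))) (-‿involutive _)) ⟩
        lower f j i * B i j     ≈⟨ if-* (does (i <? j)) (f i j) (B i j) ⟩
        _ ∎))

  FormSupport : Mat m → Mat m → Set (c ⊔ ℓ)
  FormSupport f B = Skew B × ¬ (B ≋ zeroMat) × RankLe B s × ¬ (evalForm f B ≈ 0#)

  FormSupport⇒ProjSupport : ∀ f B → FormSupport f B → ProjSupport (formMatrix f) B
  FormSupport⇒ProjSupport f B (skew , B≉0 , rank , f≉0) =
    skew , B≉0 , rank , λ tr≈0 → f≉0 (double-zero _ (trans (sym (tr-formMatrix f B skew)) tr≈0))

  ProjSupport⇒FormSupport : ∀ f B → ProjSupport (formMatrix f) B → FormSupport f B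
  ProjSupport⇒FormSupport f B (skew , B≉0 , rank , tr≉0) =
    skew , B≉0 , rank , λ f≈0 → tr≉0 (trans (tr-formMatrix f B skew) (trans (+-cong f≈0 f≈0) (+-identityʳ 0#)))

  form-weight : ∀ f k → Congruent (formMatrix f) (Nf k m) → ProjCard (FormSupport f) (projWeight k)
  form-weight f k F∼Nf = Transport.projcard (ProjSupport (formMatrix f)) (FormSupport f) (λ A → A) (λ A → A)
    (λ A≋B → A≋B) (λ A≋B → A≋B) (λ _ → ≋-refl) (λ _ → ≋-refl)
    (ProjSupport⇒FormSupport f) (FormSupport⇒ProjSupport f) (λ _ _ → ≋-refl) (λ _ _ → ≋-refl)
    (proj-weight-by-rank (formMatrix f) k F∼Nf)

  zero-form-weight : ∀ f → Congruent (formMatrix f) zeroMat → ProjCard (FormSupport f) 0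
  zero-form-weight f F∼0 = [] , ≡.refl , [] , [] , λ B (skew , _ , _ , f≉0) →
    ⊥-elim (f≉0 (double-zero _ (trans (sym (tr-formMatrix f B skew)) (begin
      tr (formMatrix f) B       ≈⟨ tr-cong (≋-trans (Congruent-inverse F∼0) (conj-zero _)) ≋-refl ⟩
      tr zeroMat B              ≈⟨ sum-zero m (λ i → sum-zero m (λ j → zeroˡ _)) ⟩
      0# ∎))))

  projective-weights : ∃ λ (ws : List ℕ) → length ws ℕ.≤ m ℕ./ 2 ×
    (∀ (f : Mat m) → ∃ λ (w : ℕ) → ProjCard (FormSupport f) w × (w ≢ 0 → w ∈ ws))
  projective-weights = ws , ℕₚ.≤-reflexive (length-applyUpTo _ (m ℕ./ 2)) ,
                       λ f → weight-of f (classify m (formMatrix f) (formMatrix-skew f))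
    where
      ws = applyUpTo (λ i → projWeight (suc i)) (m ℕ./ 2)
      weight-of : ∀ f → (∃ λ k → k ℕ.* 2 ℕ.≤ m × Congruent (formMatrix f) (Nf k m)) →
        ∃ λ (w : ℕ) → ProjCard (FormSupport f) w × (w ≢ 0 → w ∈ ws)
      weight-of f (zero , _ , F∼0) = 0 , zero-form-weight f F∼0 , λ 0≢0 → ⊥-elim (0≢0 ≡.refl)
      weight-of f (suc k , 2k≤m , F∼Nf) = projWeight (suc k) , form-weight f (suc k) F∼Nf ,
        λ _ → ∈-applyUpTo⁺ (λ i → projWeight (suc i))
                (ℕₚ.≤-trans (ℕₚ.≤-reflexive (≡.sym (m*n/n≡m (suc k) 2))) (/-monoˡ-≤ 2 2k≤m))

open import Data.Nat using (_≤_; _*_; _/_)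

-- Part 1: c_F has weight hatWeight (r / 2) for every skew F of rank r.
-- Part 2: the projective weights, with rank bound s = 2t.  Neither part
-- needs the hypotheses 1 ≤ t and 2t ≤ m.
mainTheorem3 : ∀ {c ℓ} (𝔽 : FiniteField c ℓ) → OddOrder 𝔽 →
    (m t : ℕ) → 1 ≤ t → 2 * t ≤ m →
    let open FF 𝔽 in
      (∀ (r : ℕ) → ∃ λ (w : ℕ) → ∀ (F : Mat m) → Skew F → HasRank F r →
         HatWeight m t F w)
      × (∃ λ (ws : List ℕ) → length ws ≤ m / 2 ×
           (∀ (f : Mat m) → ∃ λ (w : ℕ) → ProjWeight m t f w × (w ≢ 0 → w ∈ ws)))
mainTheorem3 𝔽 odd m t _ _ =
  (λ r → hatWeight (r / 2) , hat-weight-by-rank r) , projective-weights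
  where
    open Weights 𝔽 m (2 * t)
    open ProjectiveCode 𝔽 odd m (2 * t)
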